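{- For positive integers $n,k,t$ with $2\le k\le n$ and $t\le n$, \[\left[{n\atop k/t}\right]=\sum_{j=1}^n\binom{n}{j}(j-1)!\left[{n-j\atop k-1/t}\right].\]
   Context: For integers $m\ge0$, $k\ge1$, $t\ge0$, a mixed coloured permutation of $[m]=\{1,\ldots,m\}$ is a permutation of $[m]$ together with a colouring of its cycles with colours from $\{1,\ldots,k\}$ such that exactly $t$ cycles receive colour $1$ (the special colour) and each of the colours $2,\ldots,k$ is used on exactly one cycle; $\left[{m\atop k/t}\right]$ denotes their number. -}

module Defs where

open import Data.Nat using (ℕ; zero; suc; _≡ᵇ_; _≤ᵇ_)
open import Data.Fin using (Fin; toℕ)
open import Data.Fin.Properties using () renaming (_≟_ to _≟F_)
open import Data.Bool using (Bool; true; false; _∧_; not; if_then_else_)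
open import Data.List using (List; []; _∷_; [_]; map; concatMap; length; allFin; upTo; cartesianProduct)
open import Data.Vec using (Vec; lookup) renaming ([] to []ᵥ; _∷_ to _∷ᵥ_)
open import Data.Product using (_×_; _,_)
open import Relation.Nullary.Decidable using (⌊_⌋; does)

all : {A : Set} → (A → Bool) → List A → Bool
all p [] = true
all p (x ∷ xs) = p x ∧ all p xs

filter : {A : Set} → (A → Bool) → List A → List A
filter p [] = []
filter p (x ∷ xs) = if p x then x ∷ filter p xs else filter p xs

allVecs : {A : Set} → List A → (m : ℕ) → List (Vec A m)
allVecs xs zero = [ []ᵥ ]
allVecs xs (suc m) = concatMap (λ x → map (x ∷ᵥ_) (allVecs xs m)) xs

_⇒ᵇ_ : Bool → Bool → Bool
a ⇒ᵇ b = not a Data.Bool.∨ b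

-- A map σ : [m] → [m] given as a vector of images.
isInjective : {m : ℕ} → Vec (Fin m) m → Bool
isInjective {m} σ =
  all (λ i → all (λ j → ⌊ lookup σ i ≟F lookup σ j ⌋ ⇒ᵇ ⌊ i ≟F j ⌋) (allFin m)) (allFin m)

iter : {m : ℕ} → Vec (Fin m) m → ℕ → Fin m → Fin m
iter σ zero i = i
iter σ (suc r) i = lookup σ (iter σ r i)

-- i is the least element of its cycle under σ (orbits have size ≤ m).
-- Cycles of σ correspond bijectively to such elements.
isCycleMin : {m : ℕ} → Vec (Fin m) m → Fin m → Bool
isCycleMin {m} σ i = all (λ r → toℕ i ≤ᵇ toℕ (iter σ r i)) (upTo m)

cyclesOfColour : {m k : ℕ} → Vec (Fin m) m → Vec (Fin k) m → Fin k → ℕ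
cyclesOfColour {m} σ c j =
  length (filter (λ i → isCycleMin σ i ∧ ⌊ lookup c i ≟F j ⌋) (allFin m))

-- (σ , c) is a mixed coloured permutation with parameters k, t:
-- σ is a permutation of [m]; c is constant on cycles (so it colours cycles),
-- colours are Fin k where the colour with toℕ = 0 is the special colour "1";
-- exactly t cycles get the special colour, every other colour exactly one cycle.
isMixedColoured : {m k : ℕ} → ℕ → Vec (Fin m) m × Vec (Fin k) m → Bool
isMixedColoured {m} {k} t (σ , c) =
  isInjective σ
  ∧ all (λ i → ⌊ lookup c (lookup σ i) ≟F lookup c i ⌋) (allFin m)
  ∧ all (λ j → if toℕ j ≡ᵇ 0
                 then cyclesOfColour σ c j ≡ᵇ t
                 else cyclesOfColour σ c j ≡ᵇ 1) (allFin k)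

mixedStirling : ℕ → ℕ → ℕ → ℕ
mixedStirling m k t =
  length (filter (λ p → isMixedColoured {m} {k} t p)
                 (cartesianProduct (allVecs (allFin m) m) (allVecs (allFin k) m)))

module Submission where

-- Write a = (a₁,…,a_k) for a "colour profile" and N(m,a) for the number of
-- pairs (σ , c) of a permutation σ of [m] and a cycle-colouring c such that
-- exactly aⱼ cycles get colour j; the mixed Stirling number is N(m,a) for the
-- profile (t,1,…,1).  Removing the largest point m+1 from a structure on
-- [m+1] either deletes it from a longer cycle (m ways to re-insert it after
-- some point) or deletes a coloured fixed point, which gives the recurrence
--   N(m+1,a) = m·N(m,a) + Σ_{aⱼ ≥ 1} N(m, a - eⱼ).
-- The recurrence of the unsigned Stirling numbers of the first kind c(m,s)
-- then yields the closed form  N(m,a)·∏ aⱼ! = s!·c(m,s)  with s = Σ aⱼ.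
-- Together with the classical identity
--   Σ_{i<n} C(n,i+1)·i!·c(n-i-1,s) = (s+1)·c(n,s+1),
-- proved by induction on n with Pascal's rule, the theorem follows after
-- cancelling t!.

open import Defs
open import Data.Nat using (ℕ; zero; suc; _+_; _*_; _∸_; _≤_; _<_; z≤n; s≤s; s≤s⁻¹; _≤ᵇ_; _≡ᵇ_; _!)
open import Data.Nat.Properties
  using ( +-comm; +-assoc; +-suc; +-identityʳ; *-zeroʳ; *-identityʳ; *-comm; *-assoc
        ; *-distribˡ-+; *-distribʳ-+; *-cancelʳ-≡; m+n≡0⇒m≡0; m+n≡0⇒n≡0; +-∸-assoc
        ; m+[n∸m]≡n; m∸n+n≡m; m+n∸n≡m; m∸n≤m; ≤-refl; ≤-trans; <⇒≤; <-≤-trans; <-irrefl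
        ; n<1+n; m<n⇒0<n∸m; m≤n⇒m<n∨m≡n; ≤ᵇ⇒≤; ≤⇒≤ᵇ; ≡ᵇ⇒≡; ≡⇒≡ᵇ; _!≢0 )
open import Data.Nat.Combinatorics using (_C_; nCk+nC[k+1]≡[n+1]C[k+1]; k>n⇒nCk≡0)
open import Data.Nat.Tactic.RingSolver using (solve-∀)
open import Data.Nat.ListAction using (sum)
open import Data.Fin as F using (Fin; toℕ; inject₁; fromℕ)
open import Data.Fin.Properties
  using (_≟_; any?; pigeonhole; toℕ<n; toℕ-inject₁; toℕ-fromℕ; fromℕ≢inject₁; inject₁-injective)
open import Data.Bool using (Bool; true; false; _∧_; if_then_else_; T)
open import Data.List
  using (List; []; _∷_; map; _++_; length; concat; concatMap; cartesianProduct; allFin; tabulate; upTo; applyUpTo)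
open import Data.List.Properties using (map-applyUpTo)
open import Data.Vec as V using (Vec; lookup) renaming ([] to []ᵥ; _∷_ to _∷ᵥ_)
open import Data.Vec.Properties using (lookup∘tabulate; tabulate∘lookup; tabulate-cong; ≡-dec)
open import Data.Product using (_×_; _,_; proj₁; proj₂; Σ-syntax; ∃)
open import Data.Sum using (_⊎_; inj₁; inj₂)
open import Data.Unit using (tt)
open import Data.Empty using (⊥-elim)
open import Relation.Binary.PropositionalEquality
open import Relation.Binary.Definitions using (DecidableEquality)
open import Relation.Nullary using (Dec; yes; no; does; ¬_)
open import Relation.Nullary.Decidable using (⌊_⌋)

⟦_⟧ : Bool → ℕ
⟦ true ⟧ = 1
⟦ false ⟧ = 0

∑ : {A : Set} → List A → (A → ℕ) → ℕ
∑ [] f = 0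
∑ (x ∷ xs) f = f x + ∑ xs f

length-filter : {A : Set} (p : A → Bool) (xs : List A) → length (filter p xs) ≡ ∑ xs (λ x → ⟦ p x ⟧)
length-filter p [] = refl
length-filter p (x ∷ xs) with p x
... | true = cong suc (length-filter p xs)
... | false = length-filter p xs

∑-cong : {A : Set} (xs : List A) {f g : A → ℕ} → (∀ x → f x ≡ g x) → ∑ xs f ≡ ∑ xs g
∑-cong [] h = refl
∑-cong (x ∷ xs) h = cong₂ _+_ (h x) (∑-cong xs h)

∑-++ : {A : Set} (xs ys : List A) (f : A → ℕ) → ∑ (xs ++ ys) f ≡ ∑ xs f + ∑ ys f
∑-++ [] ys f = refl
∑-++ (x ∷ xs) ys f = trans (cong (f x +_) (∑-++ xs ys f)) (sym (+-assoc (f x) _ _))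

∑-map : {A B : Set} (g : A → B) (xs : List A) (f : B → ℕ) → ∑ (map g xs) f ≡ ∑ xs (λ x → f (g x))
∑-map g [] f = refl
∑-map g (x ∷ xs) f = cong (f (g x) +_) (∑-map g xs f)

∑-+ : {A : Set} (xs : List A) (f g : A → ℕ) → ∑ xs (λ x → f x + g x) ≡ ∑ xs f + ∑ xs g
∑-+ [] f g = refl
∑-+ (x ∷ xs) f g = trans (cong (f x + g x +_) (∑-+ xs f g)) (interchange (f x) (g x) _ _)
  where
  interchange : ∀ a b c d → a + b + (c + d) ≡ a + c + (b + d)
  interchange = solve-∀

∑-*ˡ : {A : Set} (k : ℕ) (xs : List A) (f : A → ℕ) → ∑ xs (λ x → k * f x) ≡ k * ∑ xs f
∑-*ˡ k [] f = sym (*-zeroʳ k)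
∑-*ˡ k (x ∷ xs) f = trans (cong (k * f x +_) (∑-*ˡ k xs f)) (sym (*-distribˡ-+ k (f x) _))

∑-0 : {A : Set} (xs : List A) → ∑ xs (λ _ → 0) ≡ 0
∑-0 [] = refl
∑-0 (x ∷ xs) = ∑-0 xs

∑-swap : {A B : Set} (xs : List A) (ys : List B) (f : A → B → ℕ) →
  ∑ xs (λ x → ∑ ys (λ y → f x y)) ≡ ∑ ys (λ y → ∑ xs (λ x → f x y))
∑-swap [] ys f = sym (∑-0 ys)
∑-swap (x ∷ xs) ys f =
  trans (cong (∑ ys (f x) +_) (∑-swap xs ys f)) (sym (∑-+ ys (f x) (λ y → ∑ xs (λ x' → f x' y))))

∑-cart : {A B : Set} (xs : List A) (ys : List B) (f : A × B → ℕ) →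
  ∑ (cartesianProduct xs ys) f ≡ ∑ xs (λ x → ∑ ys (λ y → f (x , y)))
∑-cart [] ys f = refl
∑-cart (x ∷ xs) ys f = trans (∑-++ (map (x ,_) ys) _ f) (cong₂ _+_ (∑-map (x ,_) ys f) (∑-cart xs ys f))

∑-concat : {A : Set} (xss : List (List A)) (f : A → ℕ) → ∑ (concat xss) f ≡ ∑ xss (λ xs → ∑ xs f)
∑-concat [] f = refl
∑-concat (xs ∷ xss) f = trans (∑-++ xs (concat xss) f) (cong (∑ xs f +_) (∑-concat xss f))

∑-concatMap : {A B : Set} (g : A → List B) (xs : List A) (f : B → ℕ) →
  ∑ (concatMap g xs) f ≡ ∑ xs (λ x → ∑ (g x) f)
∑-concatMap g xs f = trans (∑-concat (map g xs) f) (∑-map g xs (λ ys → ∑ ys f))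

Enumerates : {A : Set} → DecidableEquality A → List A → Set
Enumerates {A} _≟A_ xs = ∀ (y : A) → ∑ xs (λ x → ⟦ does (x ≟A y) ⟧) ≡ 1

∑-point : {A : Set} (_≟A_ : DecidableEquality A) (xs : List A) → Enumerates _≟A_ xs →
  (y : A) (f : A → ℕ) → (∀ x → ¬ x ≡ y → f x ≡ 0) → ∑ xs f ≡ f y
∑-point _≟A_ xs en y f off =
  trans (∑-cong xs pointwise) (trans (∑-*ˡ (f y) xs _) (trans (cong (f y *_) (en y)) (*-identityʳ (f y))))
  where
  pointwise : ∀ x → f x ≡ f y * ⟦ does (x ≟A y) ⟧
  pointwise x with x ≟A y
  ... | yes refl = sym (*-identityʳ (f x))
  ... | no x≢y = trans (off x x≢y) (sym (*-zeroʳ (f y)))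

⟦yes⟧ : {P : Set} (d : Dec P) → P → ⟦ does d ⟧ ≡ 1
⟦yes⟧ (yes _) _ = refl
⟦yes⟧ (no ¬p) p = ⊥-elim (¬p p)

⟦no⟧ : {P : Set} (d : Dec P) → ¬ P → ⟦ does d ⟧ ≡ 0
⟦no⟧ (yes p) ¬p = ⊥-elim (¬p p)
⟦no⟧ (no _) _ = refl

⟦∧⟧ : ∀ b c → ⟦ b ∧ c ⟧ ≡ ⟦ b ⟧ * ⟦ c ⟧
⟦∧⟧ true c = sym (+-identityʳ _)
⟦∧⟧ false c = refl

decPair : {A B : Set} → DecidableEquality A → DecidableEquality B → DecidableEquality (A × B)
decPair _≟A_ _≟B_ (a , x) (b , y) with a ≟A b | x ≟B y
... | yes refl | yes refl = yes refl
... | no a≢b | _ = no (λ eq → a≢b (cong proj₁ eq))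
... | yes _ | no x≢y = no (λ eq → x≢y (cong proj₂ eq))

decSum : {A B : Set} → DecidableEquality A → DecidableEquality B → DecidableEquality (A ⊎ B)
decSum _≟A_ _≟B_ (inj₁ a) (inj₁ b) with a ≟A b
... | yes refl = yes refl
... | no a≢b = no (λ { refl → a≢b refl })
decSum _≟A_ _≟B_ (inj₁ a) (inj₂ b) = no (λ ())
decSum _≟A_ _≟B_ (inj₂ a) (inj₁ b) = no (λ ())
decSum _≟A_ _≟B_ (inj₂ a) (inj₂ b) with a ≟B b
... | yes refl = yes refl
... | no a≢b = no (λ { refl → a≢b refl })

⟦decPair⟧ : {A B : Set} (_≟A_ : DecidableEquality A) (_≟B_ : DecidableEquality B) (x a : A) (y b : B) →
  ⟦ does (decPair _≟A_ _≟B_ (x , y) (a , b)) ⟧ ≡ ⟦ does (x ≟A a) ⟧ * ⟦ does (y ≟B b) ⟧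
⟦decPair⟧ _≟A_ _≟B_ x a y b with x ≟A a | y ≟B b
... | yes refl | yes refl = refl
... | yes refl | no _ = refl
... | no _ | yes _ = refl
... | no _ | no _ = refl

enum-cart : {A B : Set} (_≟A_ : DecidableEquality A) (_≟B_ : DecidableEquality B) (xs : List A) (ys : List B) →
  Enumerates _≟A_ xs → Enumerates _≟B_ ys → Enumerates (decPair _≟A_ _≟B_) (cartesianProduct xs ys)
enum-cart _≟A_ _≟B_ xs ys enA enB (a , b) = trans (∑-cart xs ys _) (trans (∑-cong xs row) (enA a))
  where
  row : ∀ x → ∑ ys (λ y → ⟦ does (decPair _≟A_ _≟B_ (x , y) (a , b)) ⟧) ≡ ⟦ does (x ≟A a) ⟧
  row x = begin
      ∑ ys (λ y → ⟦ does (decPair _≟A_ _≟B_ (x , y) (a , b)) ⟧)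
    ≡⟨ ∑-cong ys (λ y → ⟦decPair⟧ _≟A_ _≟B_ x a y b) ⟩
      ∑ ys (λ y → ⟦ does (x ≟A a) ⟧ * ⟦ does (y ≟B b) ⟧)
    ≡⟨ ∑-*ˡ ⟦ does (x ≟A a) ⟧ ys (λ y → ⟦ does (y ≟B b) ⟧) ⟩
      ⟦ does (x ≟A a) ⟧ * ∑ ys (λ y → ⟦ does (y ≟B b) ⟧)
    ≡⟨ cong (⟦ does (x ≟A a) ⟧ *_) (enB b) ⟩
      ⟦ does (x ≟A a) ⟧ * 1
    ≡⟨ *-identityʳ _ ⟩
      ⟦ does (x ≟A a) ⟧
    ∎
    where open ≡-Reasoning

enum-sum : {A B : Set} (_≟A_ : DecidableEquality A) (_≟B_ : DecidableEquality B) (xs : List A) (ys : List B) →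
  Enumerates _≟A_ xs → Enumerates _≟B_ ys → Enumerates (decSum _≟A_ _≟B_) (map inj₁ xs ++ map inj₂ ys)
enum-sum _≟A_ _≟B_ xs ys enA enB (inj₁ a) =
  trans (∑-++ (map inj₁ xs) _ _)
    (trans (cong₂ _+_ (trans (∑-map inj₁ xs _) (trans (∑-cong xs same) (enA a)))
                      (trans (∑-map inj₂ ys _) (∑-0 ys)))
           (+-identityʳ 1))
  where
  same : ∀ x → ⟦ does (decSum _≟A_ _≟B_ (inj₁ x) (inj₁ a)) ⟧ ≡ ⟦ does (x ≟A a) ⟧
  same x with x ≟A a
  ... | yes refl = refl
  ... | no _ = refl
enum-sum _≟A_ _≟B_ xs ys enA enB (inj₂ b) =
  trans (∑-++ (map inj₁ xs) _ _)
    (cong₂ _+_ (trans (∑-map inj₁ xs _) (∑-0 xs))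
               (trans (∑-map inj₂ ys _) (trans (∑-cong ys same) (enB b))))
  where
  same : ∀ y → ⟦ does (decSum _≟A_ _≟B_ (inj₂ y) (inj₂ b)) ⟧ ≡ ⟦ does (y ≟B b) ⟧
  same y with y ≟B b
  ... | yes refl = refl
  ... | no _ = refl

record Correspondence {A B : Set} (P : A → Bool) (Q : B → Bool) : Set where
  field
    to      : B → A
    from    : A → B
    to-P    : ∀ x → Q x ≡ true → P (to x) ≡ true
    from-Q  : ∀ y → P y ≡ true → Q (from y) ≡ true
    from-to : ∀ x → Q x ≡ true → from (to x) ≡ x
    to-from : ∀ y → P y ≡ true → to (from y) ≡ y

-- Bijective counting: corresponding subsets of enumerated types have equal
-- size.  Both sides equal the number of pairs (x , y) with Q x and to x = y.
count-correspondence :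
  {A B : Set} (_≟A_ : DecidableEquality A) (_≟B_ : DecidableEquality B) (LA : List A) (LB : List B) →
  Enumerates _≟A_ LA → Enumerates _≟B_ LB → {P : A → Bool} {Q : B → Bool} → Correspondence P Q →
  ∑ LA (λ y → ⟦ P y ⟧) ≡ ∑ LB (λ x → ⟦ Q x ⟧)
count-correspondence {A} {B} _≟A_ _≟B_ LA LB enA enB {P} {Q} corr =
  trans (∑-cong LA count-fibre) (trans (∑-swap LA LB (λ y x → graph x y)) (∑-cong LB count-image))
  where
  open Correspondence corr

  graph : B → A → ℕ
  graph x y = ⟦ Q x ⟧ * ⟦ does (to x ≟A y) ⟧

  -- every P-element y has exactly one Q-preimage, namely from y
  count-fibre : ∀ y → ⟦ P y ⟧ ≡ ∑ LB (λ x → graph x y)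
  count-fibre y with P y in Py
  ... | true = sym (trans (∑-point _≟B_ LB enB (from y) (λ x → graph x y) off) on)
    where
    off : ∀ x → ¬ x ≡ from y → graph x y ≡ 0
    off x x≢ with Q x in Qx
    ... | false = refl
    ... | true with to x ≟A y
    ... | yes refl = ⊥-elim (x≢ (sym (from-to x Qx)))
    ... | no _ = refl
    on : graph (from y) y ≡ 1
    on rewrite from-Q y Py = trans (+-identityʳ _) (⟦yes⟧ (to (from y) ≟A y) (to-from y Py))
  ... | false = sym (trans (∑-cong LB none) (∑-0 LB))
    where
    none : ∀ x → graph x y ≡ 0
    none x with Q x in Qx
    ... | false = refl
    ... | true with to x ≟A y
    ... | yes refl with trans (sym (to-P x Qx)) Py
    ... | ()
    none x | true | no _ = refl

  count-image : ∀ x → ∑ LA (λ y → graph x y) ≡ ⟦ Q x ⟧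
  count-image x = begin
      ∑ LA (λ y → ⟦ Q x ⟧ * ⟦ does (to x ≟A y) ⟧)
    ≡⟨ ∑-*ˡ ⟦ Q x ⟧ LA _ ⟩
      ⟦ Q x ⟧ * ∑ LA (λ y → ⟦ does (to x ≟A y) ⟧)
    ≡⟨ cong (⟦ Q x ⟧ *_) (∑-point _≟A_ LA enA (to x) _ (λ y y≢ → ⟦no⟧ (to x ≟A y) (λ e → y≢ (sym e)))) ⟩
      ⟦ Q x ⟧ * ⟦ does (to x ≟A to x) ⟧
    ≡⟨ cong (⟦ Q x ⟧ *_) (⟦yes⟧ (to x ≟A to x) refl) ⟩
      ⟦ Q x ⟧ * 1
    ≡⟨ *-identityʳ _ ⟩
      ⟦ Q x ⟧
    ∎
    where open ≡-Reasoning

∧-true : ∀ {a b} → a ∧ b ≡ true → a ≡ true × b ≡ true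
∧-true {true} {true} _ = refl , refl

∧-intro : ∀ {a b} → a ≡ true → b ≡ true → a ∧ b ≡ true
∧-intro refl refl = refl

bool-ext : ∀ {a b} → (a ≡ true → b ≡ true) → (b ≡ true → a ≡ true) → a ≡ b
bool-ext {true} {true} f g = refl
bool-ext {true} {false} f g = sym (f refl)
bool-ext {false} {true} f g = g refl
bool-ext {false} {false} f g = refl

all-tabulate⁻ : ∀ {A : Set} {n} (p : A → Bool) (f : Fin n → A) → all p (tabulate f) ≡ true → ∀ i → p (f i) ≡ true
all-tabulate⁻ {n = suc n} p f h F.zero = proj₁ (∧-true h)
all-tabulate⁻ {n = suc n} p f h (F.suc i) = all-tabulate⁻ p (λ x → f (F.suc x)) (proj₂ (∧-true h)) i

all-tabulate⁺ : ∀ {A : Set} {n} (p : A → Bool) (f : Fin n → A) → (∀ i → p (f i) ≡ true) → all p (tabulate f) ≡ true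
all-tabulate⁺ {n = zero} p f h = refl
all-tabulate⁺ {n = suc n} p f h = ∧-intro (h F.zero) (all-tabulate⁺ p (λ x → f (F.suc x)) (λ i → h (F.suc i)))

all-allFin⁻ : ∀ {n} (p : Fin n → Bool) → all p (allFin n) ≡ true → ∀ i → p i ≡ true
all-allFin⁻ p = all-tabulate⁻ p (λ x → x)

all-allFin⁺ : ∀ {n} (p : Fin n → Bool) → (∀ i → p i ≡ true) → all p (allFin n) ≡ true
all-allFin⁺ p = all-tabulate⁺ p (λ x → x)

all-upTo⁻ : ∀ (p : ℕ → Bool) n → all p (upTo n) ≡ true → ∀ r → r < n → p r ≡ true
all-upTo⁻ p n = go (λ x → x) n
  where
  go : ∀ (f : ℕ → ℕ) n → all p (applyUpTo f n) ≡ true → ∀ r → r < n → p (f r) ≡ true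
  go f (suc n) h zero _ = proj₁ (∧-true h)
  go f (suc n) h (suc r) r<n = go (λ x → f (suc x)) n (proj₂ (∧-true h)) r (s≤s⁻¹ r<n)

all-upTo⁺ : ∀ (p : ℕ → Bool) n → (∀ r → r < n → p r ≡ true) → all p (upTo n) ≡ true
all-upTo⁺ p n = go (λ x → x) n
  where
  go : ∀ (f : ℕ → ℕ) n → (∀ r → r < n → p (f r) ≡ true) → all p (applyUpTo f n) ≡ true
  go f zero h = refl
  go f (suc n) h = ∧-intro (h 0 (s≤s z≤n)) (go (λ x → f (suc x)) n (λ r r<n → h (suc r) (s≤s r<n)))

≤ᵇ-true⁻ : ∀ {a b} → (a ≤ᵇ b) ≡ true → a ≤ b
≤ᵇ-true⁻ {a} {b} h = ≤ᵇ⇒≤ a b (subst T (sym h) tt)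

≤ᵇ-true⁺ : ∀ {a b} → a ≤ b → (a ≤ᵇ b) ≡ true
≤ᵇ-true⁺ {a} {b} h with a ≤ᵇ b | ≤⇒≤ᵇ h
... | true | _ = refl

≡ᵇ-true⁻ : ∀ {a b} → (a ≡ᵇ b) ≡ true → a ≡ b
≡ᵇ-true⁻ {a} {b} h = ≡ᵇ⇒≡ a b (subst T (sym h) tt)

≡ᵇ-true⁺ : ∀ {a b} → a ≡ b → (a ≡ᵇ b) ≡ true
≡ᵇ-true⁺ {a} {b} h with a ≡ᵇ b | ≡⇒≡ᵇ a b h
... | true | _ = refl

∑F : ∀ {n} → (Fin n → ℕ) → ℕ
∑F {zero} f = 0
∑F {suc n} f = f F.zero + ∑F (λ x → f (F.suc x))

∏F : ∀ {n} → (Fin n → ℕ) → ℕ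
∏F {zero} f = 1
∏F {suc n} f = f F.zero * ∏F (λ x → f (F.suc x))

∑-allFin : ∀ {n} (f : Fin n → ℕ) → ∑ (allFin n) f ≡ ∑F f
∑-allFin f = go (λ x → x)
  where
  go : ∀ {n} (g : Fin n → _) → ∑ (tabulate g) f ≡ ∑F (λ x → f (g x))
  go {zero} g = refl
  go {suc n} g = cong (f (g F.zero) +_) (go (λ x → g (F.suc x)))

∑F-cong : ∀ {n} {f g : Fin n → ℕ} → (∀ x → f x ≡ g x) → ∑F f ≡ ∑F g
∑F-cong {zero} h = refl
∑F-cong {suc n} h = cong₂ _+_ (h F.zero) (∑F-cong (λ x → h (F.suc x)))

∏F-cong : ∀ {n} {f g : Fin n → ℕ} → (∀ x → f x ≡ g x) → ∏F f ≡ ∏F g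
∏F-cong {zero} h = refl
∏F-cong {suc n} h = cong₂ _*_ (h F.zero) (∏F-cong (λ x → h (F.suc x)))

∑F-last : ∀ {m} (f : Fin (suc m) → ℕ) → ∑F f ≡ ∑F (λ x → f (inject₁ x)) + f (fromℕ m)
∑F-last {zero} f = +-comm (f F.zero) 0
∑F-last {suc m} f = trans (cong (f F.zero +_) (∑F-last (λ x → f (F.suc x)))) (sym (+-assoc (f F.zero) _ _))

∑F-const : ∀ {n} x → ∑F {n} (λ _ → x) ≡ n * x
∑F-const {zero} x = refl
∑F-const {suc n} x = cong (x +_) (∑F-const {n} x)

∏F-1 : ∀ {n} → ∏F {n} (λ _ → 1) ≡ 1
∏F-1 {zero} = refl
∏F-1 {suc n} = trans (+-identityʳ _) (∏F-1 {n})

∑F-*ʳ : ∀ {n} (f : Fin n → ℕ) x → ∑F (λ j → f j * x) ≡ ∑F f * x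
∑F-*ʳ {zero} f x = refl
∑F-*ʳ {suc n} f x = trans (cong (f F.zero * x +_) (∑F-*ʳ (λ y → f (F.suc y)) x)) (sym (*-distribʳ-+ x (f F.zero) _))

∑F-zero⁻ : ∀ {n} (f : Fin n → ℕ) → ∑F f ≡ 0 → ∀ j → f j ≡ 0
∑F-zero⁻ {suc n} f h F.zero = m+n≡0⇒m≡0 (f F.zero) h
∑F-zero⁻ {suc n} f h (F.suc j) = ∑F-zero⁻ (λ y → f (F.suc y)) (m+n≡0⇒n≡0 (f F.zero) h) j

∑F-zero⁺ : ∀ {n} (f : Fin n → ℕ) → (∀ j → f j ≡ 0) → ∑F f ≡ 0
∑F-zero⁺ {zero} f h = refl
∑F-zero⁺ {suc n} f h rewrite h F.zero = ∑F-zero⁺ (λ y → f (F.suc y)) (λ j → h (F.suc j))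

enum-allFin : ∀ n → Enumerates (_≟_ {n}) (allFin n)
enum-allFin n y = trans (∑-allFin {n} (λ x → ⟦ does (x ≟ y) ⟧)) (go y)
  where
  go : ∀ {n} (y : Fin n) → ∑F (λ x → ⟦ does (x ≟ y) ⟧) ≡ 1
  go {suc n} F.zero = cong suc (∑F-zero⁺ {n} (λ _ → 0) (λ _ → refl))
  go {suc n} (F.suc y) = trans (∑F-cong suc≟suc) (go y)
    where
    suc≟suc : ∀ x → ⟦ does (F.suc x ≟ F.suc y) ⟧ ≡ ⟦ does (x ≟ y) ⟧
    suc≟suc x with x ≟ y
    ... | yes refl = refl
    ... | no _ = refl

⟦≡-dec-∷⟧ : {A : Set} (_≟A_ : DecidableEquality A) {n : ℕ} (x y : A) (v w : Vec A n) →
  ⟦ does (≡-dec _≟A_ (x ∷ᵥ v) (y ∷ᵥ w)) ⟧ ≡ ⟦ does (x ≟A y) ⟧ * ⟦ does (≡-dec _≟A_ v w) ⟧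
⟦≡-dec-∷⟧ _≟A_ x y v w with x ≟A y | ≡-dec _≟A_ v w
... | yes refl | yes refl = refl
... | yes refl | no _ = refl
... | no _ | _ = refl

enum-allVecs : {A : Set} (_≟A_ : DecidableEquality A) (xs : List A) → Enumerates _≟A_ xs →
  ∀ m → Enumerates (≡-dec {n = m} _≟A_) (allVecs xs m)
enum-allVecs _≟A_ xs en zero []ᵥ = refl
enum-allVecs _≟A_ xs en (suc m) (y ∷ᵥ w) =
  trans (∑-concatMap _ xs _) (trans (∑-cong xs byHead) (en y))
  where
  byHead : ∀ x → ∑ (map (x ∷ᵥ_) (allVecs xs m)) (λ v → ⟦ does (≡-dec _≟A_ v (y ∷ᵥ w)) ⟧) ≡ ⟦ does (x ≟A y) ⟧
  byHead x = begin
      ∑ (map (x ∷ᵥ_) (allVecs xs m)) (λ v → ⟦ does (≡-dec _≟A_ v (y ∷ᵥ w)) ⟧)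
    ≡⟨ ∑-map (x ∷ᵥ_) (allVecs xs m) _ ⟩
      ∑ (allVecs xs m) (λ v → ⟦ does (≡-dec _≟A_ (x ∷ᵥ v) (y ∷ᵥ w)) ⟧)
    ≡⟨ ∑-cong (allVecs xs m) (λ v → ⟦≡-dec-∷⟧ _≟A_ x y v w) ⟩
      ∑ (allVecs xs m) (λ v → ⟦ does (x ≟A y) ⟧ * ⟦ does (≡-dec _≟A_ v w) ⟧)
    ≡⟨ ∑-*ˡ ⟦ does (x ≟A y) ⟧ (allVecs xs m) _ ⟩
      ⟦ does (x ≟A y) ⟧ * ∑ (allVecs xs m) (λ v → ⟦ does (≡-dec _≟A_ v w) ⟧)
    ≡⟨ cong (⟦ does (x ≟A y) ⟧ *_) (enum-allVecs _≟A_ xs en m w) ⟩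
      ⟦ does (x ≟A y) ⟧ * 1
    ≡⟨ *-identityʳ _ ⟩
      ⟦ does (x ≟A y) ⟧
    ∎
    where open ≡-Reasoning

Inj : ∀ {n} → Vec (Fin n) n → Set
Inj σ = ∀ i j → lookup σ i ≡ lookup σ j → i ≡ j

ConstOnCycles : ∀ {m k} → Vec (Fin m) m → Vec (Fin k) m → Set
ConstOnCycles σ c = ∀ i → lookup c (lookup σ i) ≡ lookup c i

isInjective⁻ : ∀ {n} (σ : Vec (Fin n) n) → isInjective σ ≡ true → Inj σ
isInjective⁻ {n} σ h i j e = reflect (all-allFin⁻ _ (all-allFin⁻ _ h i) j)
  where
  reflect : (⌊ lookup σ i ≟ lookup σ j ⌋ ⇒ᵇ ⌊ i ≟ j ⌋) ≡ true → i ≡ j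
  reflect h' with lookup σ i ≟ lookup σ j
  ... | no ne = ⊥-elim (ne e)
  ... | yes _ with i ≟ j
  ... | yes i≡j = i≡j
  reflect () | yes _ | no _

isInjective⁺ : ∀ {n} (σ : Vec (Fin n) n) → Inj σ → isInjective σ ≡ true
isInjective⁺ {n} σ inj = all-allFin⁺ _ (λ i → all-allFin⁺ _ (λ j → reflect i j))
  where
  reflect : ∀ i j → (⌊ lookup σ i ≟ lookup σ j ⌋ ⇒ᵇ ⌊ i ≟ j ⌋) ≡ true
  reflect i j with lookup σ i ≟ lookup σ j
  ... | no _ = refl
  ... | yes e with i ≟ j
  ... | yes _ = refl
  ... | no ne = ⊥-elim (ne (inj i j e))

isConst : ∀ {m k} → Vec (Fin m) m → Vec (Fin k) m → Bool
isConst {m} σ c = all (λ i → ⌊ lookup c (lookup σ i) ≟ lookup c i ⌋) (allFin m)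

isConst⁻ : ∀ {m k} (σ : Vec (Fin m) m) (c : Vec (Fin k) m) → isConst σ c ≡ true → ConstOnCycles σ c
isConst⁻ σ c h i with lookup c (lookup σ i) ≟ lookup c i | all-allFin⁻ _ h i
... | yes e | _ = e

isConst⁺ : ∀ {m k} (σ : Vec (Fin m) m) (c : Vec (Fin k) m) → ConstOnCycles σ c → isConst σ c ≡ true
isConst⁺ σ c h = all-allFin⁺ _ reflect
  where
  reflect : ∀ i → ⌊ lookup c (lookup σ i) ≟ lookup c i ⌋ ≡ true
  reflect i with lookup c (lookup σ i) ≟ lookup c i
  ... | yes _ = refl
  ... | no ne = ⊥-elim (ne (h i))

iter-+ : ∀ {n} (σ : Vec (Fin n) n) r s x → iter σ (r + s) x ≡ iter σ r (iter σ s x)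
iter-+ σ zero s x = refl
iter-+ σ (suc r) s x = cong (lookup σ) (iter-+ σ r s x)

iter-injective : ∀ {n} (σ : Vec (Fin n) n) → Inj σ → ∀ r {x y} → iter σ r x ≡ iter σ r y → x ≡ y
iter-injective σ inj zero e = e
iter-injective σ inj (suc r) e = iter-injective σ inj r (inj _ _ e)

-- Every point of a permutation of [n] returns to itself after p steps, 0 < p ≤ n
-- (pigeonhole on the first n+1 iterates, then cancel by injectivity).
period : ∀ {n} (σ : Vec (Fin n) n) → Inj σ → ∀ x → Σ[ p ∈ ℕ ] (0 < p × p ≤ n × iter σ p x ≡ x)
period {n} σ inj x with pigeonhole (n<1+n n) (λ a → iter σ (toℕ a) x)
... | i , j , i<j , e = p , m<n⇒0<n∸m i<j , p≤n , iter-injective σ inj (toℕ i) returns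
  where
  p = toℕ j ∸ toℕ i
  i+p≡j : toℕ i + p ≡ toℕ j
  i+p≡j = trans (+-comm (toℕ i) p) (m∸n+n≡m (<⇒≤ i<j))
  p≤n : p ≤ n
  p≤n = ≤-trans (m∸n≤m (toℕ j) (toℕ i)) (s≤s⁻¹ (toℕ<n j))
  returns : iter σ (toℕ i) (iter σ p x) ≡ iter σ (toℕ i) x
  returns = trans (sym (iter-+ σ (toℕ i) p x)) (trans (cong (λ z → iter σ z x) i+p≡j) (sym e))

iterate-mod-period : ∀ {n} (σ : Vec (Fin n) n) x p → 0 < p → iter σ p x ≡ x →
  ∀ r → Σ[ r' ∈ ℕ ] (r' < p × iter σ r x ≡ iter σ r' x)
iterate-mod-period σ x p p>0 back zero = 0 , p>0 , refl
iterate-mod-period σ x p p>0 back (suc r) with iterate-mod-period σ x p p>0 back r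
... | r' , r'<p , e with m≤n⇒m<n∨m≡n r'<p
... | inj₁ r'+1<p = suc r' , r'+1<p , cong (lookup σ) e
... | inj₂ r'+1≡p = 0 , p>0 , trans (cong (lookup σ) e) (trans (cong (λ z → iter σ z x) r'+1≡p) back)

iterate-bounded : ∀ {n} (σ : Vec (Fin n) n) → Inj σ → ∀ x r → Σ[ r' ∈ ℕ ] (r' < n × iter σ r x ≡ iter σ r' x)
iterate-bounded {n} σ inj x r with period σ inj x
... | p , p>0 , p≤n , back with iterate-mod-period σ x p p>0 back r
... | r' , r'<p , e = r' , <-≤-trans r'<p p≤n , e

CycleMin : ∀ {n} → Vec (Fin n) n → Fin n → Set
CycleMin σ i = ∀ r → toℕ i ≤ toℕ (iter σ r i)

isCycleMin⁻ : ∀ {n} (σ : Vec (Fin n) n) → Inj σ → ∀ i → isCycleMin σ i ≡ true → CycleMin σ i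
isCycleMin⁻ {n} σ inj i h r with iterate-bounded σ inj i r
... | r' , r'<n , e = subst (λ z → toℕ i ≤ toℕ z) (sym e) (≤ᵇ-true⁻ (all-upTo⁻ _ n h r' r'<n))

isCycleMin⁺ : ∀ {n} (σ : Vec (Fin n) n) → ∀ i → CycleMin σ i → isCycleMin σ i ≡ true
isCycleMin⁺ {n} σ i h = all-upTo⁺ _ n (λ r _ → ≤ᵇ-true⁺ (h r))

inject-or-last : ∀ {m} (v : Fin (suc m)) → (Σ[ x ∈ Fin m ] v ≡ inject₁ x) ⊎ (v ≡ fromℕ m)
inject-or-last {zero} F.zero = inj₂ refl
inject-or-last {suc m} F.zero = inj₁ (F.zero , refl)
inject-or-last {suc m} (F.suc v) with inject-or-last v
... | inj₁ (x , e) = inj₁ (F.suc x , cong F.suc e)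
... | inj₂ e = inj₂ (cong F.suc e)

inject≢last : ∀ {m} (x : Fin m) → ¬ inject₁ x ≡ fromℕ m
inject≢last x e = fromℕ≢inject₁ (sym e)

extend : ∀ {A : Set} {m} → (Fin m → A) → A → Fin (suc m) → A
extend {m = zero} f a F.zero = a
extend {m = suc m} f a F.zero = f F.zero
extend {m = suc m} f a (F.suc v) = extend (λ x → f (F.suc x)) a v

extend-inject : ∀ {A : Set} {m} (f : Fin m → A) a x → extend f a (inject₁ x) ≡ f x
extend-inject {m = suc m} f a F.zero = refl
extend-inject {m = suc m} f a (F.suc x) = extend-inject (λ y → f (F.suc y)) a x

extend-last : ∀ {A : Set} {m} (f : Fin m → A) a → extend f a (fromℕ m) ≡ a
extend-last {m = zero} f a = refl
extend-last {m = suc m} f a = extend-last (λ y → f (F.suc y)) a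

squash : ∀ {m} → Fin m → Fin (suc m) → Fin m
squash d = extend (λ x → x) d

lookup-extend-inject : ∀ {A : Set} {m} (f : Fin m → A) a x → lookup (V.tabulate (extend f a)) (inject₁ x) ≡ f x
lookup-extend-inject f a x = trans (lookup∘tabulate (extend f a) (inject₁ x)) (extend-inject f a x)

lookup-extend-last : ∀ {A : Set} {m} (f : Fin m → A) a → lookup (V.tabulate (extend f a)) (fromℕ m) ≡ a
lookup-extend-last f a = trans (lookup∘tabulate (extend f a) _) (extend-last f a)

vec-ext : ∀ {A : Set} {n} {u v : Vec A n} → (∀ x → lookup u x ≡ lookup v x) → u ≡ v
vec-ext {u = u} {v} h = trans (sym (tabulate∘lookup u)) (trans (tabulate-cong h) (tabulate∘lookup v))

-- Deleting the last point from a permutation of [m+1]: the point mapped to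
-- the last point is sent instead to the image of the last point.
removeLast : ∀ {m} → Vec (Fin (suc m)) (suc m) → Vec (Fin m) m
removeLast {m} σ = V.tabulate (λ x → squash (squash x (lookup σ (fromℕ m))) (lookup σ (inject₁ x)))

restrict : ∀ {m k} → Vec (Fin k) (suc m) → Vec (Fin k) m
restrict c = V.tabulate (λ x → lookup c (inject₁ x))

lookup-restrict : ∀ {m k} (c : Vec (Fin k) (suc m)) x → lookup (restrict c) x ≡ lookup c (inject₁ x)
lookup-restrict c x = lookup∘tabulate (λ y → lookup c (inject₁ y)) x

module RemoveLast {m : ℕ} (σ : Vec (Fin (suc m)) (suc m)) (inj : Inj σ) where

  σ' : Vec (Fin m) m
  σ' = removeLast σ

  last = fromℕ m

  step : ∀ y → (lookup σ (inject₁ y) ≡ inject₁ (lookup σ' y))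
             ⊎ (lookup σ (inject₁ y) ≡ last × lookup σ last ≡ inject₁ (lookup σ' y))
  step y rewrite lookup∘tabulate (λ x → squash (squash x (lookup σ last)) (lookup σ (inject₁ x))) y
    with inject-or-last (lookup σ (inject₁ y))
  ... | inj₁ (z , e) rewrite e | extend-inject (λ x → x) (squash y (lookup σ last)) z = inj₁ refl
  ... | inj₂ e with inject-or-last (lookup σ last)
  ... | inj₁ (z , e₂) rewrite e | e₂ | extend-last (λ x → x) (squash y (inject₁ z)) | extend-inject (λ x → x) y z
    = inj₂ (refl , refl)
  ... | inj₂ e₂ = ⊥-elim (inject≢last y (inj _ _ (trans e (sym e₂))))

  injective : Inj σ'
  injective a b e with step a | step b
  ... | inj₁ ea | inj₁ eb = inject₁-injective (inj _ _ (trans ea (trans (cong inject₁ e) (sym eb))))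
  ... | inj₂ (ea , _) | inj₂ (eb , _) = inject₁-injective (inj _ _ (trans ea (sym eb)))
  ... | inj₁ ea | inj₂ (_ , eb) = ⊥-elim (inject≢last a (inj _ _ (trans ea (trans (cong inject₁ e) (sym eb)))))
  ... | inj₂ (_ , ea) | inj₁ eb = ⊥-elim (inject≢last b (inj _ _ (trans eb (trans (cong inject₁ (sym e)) (sym ea)))))

  const : ∀ {k} (c : Vec (Fin k) (suc m)) → ConstOnCycles σ c → ConstOnCycles σ' (restrict c)
  const c cst x rewrite lookup-restrict c (lookup σ' x) | lookup-restrict c x with step x
  ... | inj₁ e = trans (cong (lookup c) (sym e)) (cst (inject₁ x))
  ... | inj₂ (e₁ , e₂) =
    trans (cong (lookup c) (sym e₂)) (trans (cst last) (trans (cong (lookup c) (sym e₁)) (cst (inject₁ x))))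

  orbit→ : ∀ i r → Σ[ t ∈ ℕ ] inject₁ (iter σ' r i) ≡ iter σ t (inject₁ i)
  orbit→ i zero = 0 , refl
  orbit→ i (suc r) with orbit→ i r | step (iter σ' r i)
  ... | t , e | inj₁ e₁ = suc t , trans (sym e₁) (cong (lookup σ) e)
  ... | t , e | inj₂ (e₁ , e₂) =
    suc (suc t) , trans (sym e₂) (trans (cong (lookup σ) (sym e₁)) (cong (lookup σ) (cong (lookup σ) e)))

  orbit← : ∀ i t → (Σ[ r ∈ ℕ ] iter σ t (inject₁ i) ≡ inject₁ (iter σ' r i))
                 ⊎ (iter σ t (inject₁ i) ≡ last × Σ[ r ∈ ℕ ] lookup σ last ≡ inject₁ (iter σ' r i))
  orbit← i zero = inj₁ (0 , refl)
  orbit← i (suc t) with orbit← i t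
  ... | inj₁ (r , e) with step (iter σ' r i)
  ... | inj₁ e₁ = inj₁ (suc r , trans (cong (lookup σ) e) e₁)
  ... | inj₂ (e₁ , e₂) = inj₂ (trans (cong (lookup σ) e) e₁ , suc r , e₂)
  orbit← i (suc t) | inj₂ (e , r , e₂) = inj₁ (r , trans (cong (lookup σ) e) e₂)

  cycleMin-inject : ∀ i → isCycleMin σ (inject₁ i) ≡ isCycleMin σ' i
  cycleMin-inject i =
    bool-ext (λ h → isCycleMin⁺ σ' i (down (isCycleMin⁻ σ inj (inject₁ i) h)))
             (λ h → isCycleMin⁺ σ (inject₁ i) (up (isCycleMin⁻ σ' injective i h)))
    where
    down : CycleMin σ (inject₁ i) → CycleMin σ' i
    down h r with orbit→ i r
    ... | t , e = subst₂ _≤_ (toℕ-inject₁ i) (trans (cong toℕ (sym e)) (toℕ-inject₁ _)) (h t)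
    up : CycleMin σ' i → CycleMin σ (inject₁ i)
    up h t with orbit← i t
    ... | inj₁ (r , e) = subst₂ _≤_ (sym (toℕ-inject₁ i)) (trans (sym (toℕ-inject₁ _)) (cong toℕ (sym e))) (h r)
    ... | inj₂ (e , _) =
      subst₂ _≤_ (sym (toℕ-inject₁ i)) (trans (sym (toℕ-fromℕ m)) (cong toℕ (sym e))) (<⇒≤ (toℕ<n i))

  iterate-fixed : lookup σ last ≡ last → ∀ r → iter σ r last ≡ last
  iterate-fixed e zero = refl
  iterate-fixed e (suc r) = trans (cong (lookup σ) (iterate-fixed e r)) e

  cycleMin-last : isCycleMin σ last ≡ does (lookup σ last ≟ last)
  cycleMin-last with lookup σ last ≟ last
  ... | yes e = isCycleMin⁺ σ last (λ r → subst (λ z → toℕ last ≤ toℕ z) (sym (iterate-fixed e r)) ≤-refl)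
  ... | no ne with isCycleMin σ last in isMin
  ... | false = refl
  ... | true with inject-or-last (lookup σ last)
  ... | inj₂ e = ⊥-elim (ne e)
  ... | inj₁ (z , e) = ⊥-elim (<-irrefl refl (<-≤-trans (toℕ<n z) m≤z))
    where
    m≤z : m ≤ toℕ z
    m≤z = subst₂ _≤_ (toℕ-fromℕ m) (trans (cong toℕ e) (toℕ-inject₁ z)) (isCycleMin⁻ σ inj last isMin 1)

  cycles-removeLast : ∀ {k} (c : Vec (Fin k) (suc m)) j →
    cyclesOfColour σ c j
      ≡ cyclesOfColour σ' (restrict c) j + ⟦ does (lookup σ last ≟ last) ∧ ⌊ lookup c last ≟ j ⌋ ⟧
  cycles-removeLast {k} c j = begin
      cyclesOfColour σ c j
    ≡⟨ trans (length-filter p (allFin (suc m))) (∑-allFin (λ v → ⟦ p v ⟧)) ⟩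
      ∑F (λ v → ⟦ p v ⟧)
    ≡⟨ ∑F-last (λ v → ⟦ p v ⟧) ⟩
      ∑F (λ x → ⟦ p (inject₁ x) ⟧) + ⟦ p last ⟧
    ≡⟨ cong₂ _+_ (∑F-cong firstPoints) (cong (λ b → ⟦ b ∧ ⌊ lookup c last ≟ j ⌋ ⟧) cycleMin-last) ⟩
      ∑F (λ x → ⟦ p' x ⟧) + ⟦ does (lookup σ last ≟ last) ∧ ⌊ lookup c last ≟ j ⌋ ⟧
    ≡⟨ cong (_+ ⟦ does (lookup σ last ≟ last) ∧ ⌊ lookup c last ≟ j ⌋ ⟧) (sym (trans (length-filter p' (allFin m)) (∑-allFin (λ v → ⟦ p' v ⟧)))) ⟩
      cyclesOfColour σ' (restrict c) j + ⟦ does (lookup σ last ≟ last) ∧ ⌊ lookup c last ≟ j ⌋ ⟧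
    ∎
    where
    open ≡-Reasoning
    p : Fin (suc m) → Bool
    p i = isCycleMin σ i ∧ ⌊ lookup c i ≟ j ⌋
    p' : Fin m → Bool
    p' i = isCycleMin σ' i ∧ ⌊ lookup (restrict c) i ≟ j ⌋
    firstPoints : ∀ x → ⟦ p (inject₁ x) ⟧ ≡ ⟦ p' x ⟧
    firstPoints x = cong₂ (λ b d → ⟦ b ∧ ⌊ d ≟ j ⌋ ⟧) (cycleMin-inject x) (sym (lookup-restrict c x))

Structure : ℕ → ℕ → Set
Structure m k = Vec (Fin m) m × Vec (Fin k) m

Profile : ∀ {m k} → (Fin k → ℕ) → Vec (Fin m) m → Vec (Fin k) m → Set
Profile a σ c = ∀ j → cyclesOfColour σ c j ≡ a j

hasProfile : ∀ {m k} → (Fin k → ℕ) → Structure m k → Bool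
hasProfile {m} {k} a (σ , c) = isInjective σ ∧ (isConst σ c ∧ all (λ j → cyclesOfColour σ c j ≡ᵇ a j) (allFin k))

hasProfile⁻ : ∀ {m k} (a : Fin k → ℕ) σ c → hasProfile {m} a (σ , c) ≡ true → Inj σ × ConstOnCycles σ c × Profile a σ c
hasProfile⁻ a σ c h with ∧-true h
... | injσ , rest with ∧-true rest
... | cst , counts = isInjective⁻ σ injσ , isConst⁻ σ c cst , (λ j → ≡ᵇ-true⁻ (all-allFin⁻ _ counts j))

hasProfile⁺ : ∀ {m k} (a : Fin k → ℕ) σ c → Inj σ → ConstOnCycles σ c → Profile a σ c → hasProfile {m} a (σ , c) ≡ true
hasProfile⁺ a σ c inj cst counts =
  ∧-intro (isInjective⁺ σ inj) (∧-intro (isConst⁺ σ c cst) (all-allFin⁺ _ (λ j → ≡ᵇ-true⁺ (counts j))))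

⟦no∧⟧ : {P : Set} (d : Dec P) → ¬ P → ∀ b → ⟦ does d ∧ b ⟧ ≡ 0
⟦no∧⟧ (yes p) ¬p b = ⊥-elim (¬p p)
⟦no∧⟧ (no _) ¬p b = refl

⟦yes∧⟧ : {P : Set} (d : Dec P) → P → ∀ b → ⟦ does d ∧ b ⟧ ≡ ⟦ b ⟧
⟦yes∧⟧ (yes p) _ b = refl
⟦yes∧⟧ (no ¬p) p b = ⊥-elim (¬p p)

-- Inserting the last point into the cycle of σ' right after i (it takes the
-- colour of that cycle): the result has the same profile as (σ' , c').
module InsertAfter {m k : ℕ} (σ' : Vec (Fin m) m) (c' : Vec (Fin k) m) (i : Fin m) where

  last = fromℕ m

  next : Fin m → Fin (suc m)
  next x = if ⌊ x ≟ i ⌋ then last else inject₁ (lookup σ' x)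

  σ : Vec (Fin (suc m)) (suc m)
  σ = V.tabulate (extend next (inject₁ (lookup σ' i)))

  c : Vec (Fin k) (suc m)
  c = V.tabulate (extend (lookup c') (lookup c' i))

  next-i : next i ≡ last
  next-i with i ≟ i
  ... | yes _ = refl
  ... | no ne = ⊥-elim (ne refl)

  next-other : ∀ x → ¬ x ≡ i → next x ≡ inject₁ (lookup σ' x)
  next-other x x≢i with x ≟ i
  ... | yes e = ⊥-elim (x≢i e)
  ... | no _ = refl

  last-moves : ¬ lookup σ last ≡ last
  last-moves e = inject≢last _ (trans (sym (lookup-extend-last next _)) e)

  removeLast-σ : removeLast σ ≡ σ'
  removeLast-σ = vec-ext pointwise
    where
    pointwise : ∀ x → lookup (removeLast σ) x ≡ lookup σ' x
    pointwise x rewrite lookup∘tabulate (λ y → squash (squash y (lookup σ last)) (lookup σ (inject₁ y))) x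
                      | lookup-extend-last next (inject₁ (lookup σ' i)) | lookup-extend-inject next (inject₁ (lookup σ' i)) x
      with x ≟ i
    ... | yes refl = trans (extend-last (λ y → y) _) (extend-inject (λ y → y) x (lookup σ' x))
    ... | no _ = extend-inject (λ y → y) _ (lookup σ' x)

  restrict-c : restrict c ≡ c'
  restrict-c = vec-ext (λ x → trans (lookup-restrict c x) (lookup-extend-inject (lookup c') _ x))

  next-avoids : Inj σ' → ∀ x → ¬ next x ≡ inject₁ (lookup σ' i)
  next-avoids inj x e with x ≟ i
  ... | yes refl = inject≢last _ (sym e)
  ... | no x≢i = x≢i (inj x i (inject₁-injective e))

  next-injective : Inj σ' → ∀ x y → next x ≡ next y → x ≡ y
  next-injective inj x y e with x ≟ i | y ≟ i
  ... | yes refl | yes refl = refl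
  ... | yes refl | no _ = ⊥-elim (inject≢last _ (sym e))
  ... | no _ | yes refl = ⊥-elim (inject≢last _ e)
  ... | no _ | no _ = inj x y (inject₁-injective e)

  injective : Inj σ' → Inj σ
  injective inj a b e with inject-or-last a | inject-or-last b
  ... | inj₁ (x , refl) | inj₁ (y , refl) =
    cong inject₁ (next-injective inj x y (trans (sym (lookup-extend-inject next _ x)) (trans e (lookup-extend-inject next _ y))))
  ... | inj₁ (x , refl) | inj₂ refl =
    ⊥-elim (next-avoids inj x (trans (sym (lookup-extend-inject next _ x)) (trans e (lookup-extend-last next _))))
  ... | inj₂ refl | inj₁ (y , refl) =
    ⊥-elim (next-avoids inj y (trans (sym (lookup-extend-inject next _ y)) (trans (sym e) (lookup-extend-last next _))))
  ... | inj₂ refl | inj₂ refl = refl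

  c-last : lookup c last ≡ lookup c' i
  c-last = lookup-extend-last (lookup c') _

  const : ConstOnCycles σ' c' → ConstOnCycles σ c
  const cst v with inject-or-last v
  ... | inj₂ refl rewrite lookup-extend-last next (inject₁ (lookup σ' i))
                        | lookup-extend-inject (lookup c') (lookup c' i) (lookup σ' i) | c-last = cst i
  ... | inj₁ (x , refl) rewrite lookup-extend-inject next (inject₁ (lookup σ' i)) x
                              | lookup-extend-inject (lookup c') (lookup c' i) x with x ≟ i
  ... | yes refl = lookup-extend-last (lookup c') _
  ... | no _ = trans (lookup-extend-inject (lookup c') _ (lookup σ' x)) (cst x)

  profile : ∀ (a : Fin k → ℕ) → Inj σ' → Profile a σ' c' → Profile a σ c
  profile a inj counts j = begin
      cyclesOfColour σ c j
    ≡⟨ RemoveLast.cycles-removeLast σ (injective inj) c j ⟩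
      cyclesOfColour (removeLast σ) (restrict c) j + ⟦ does (lookup σ last ≟ last) ∧ ⌊ lookup c last ≟ j ⌋ ⟧
    ≡⟨ cong₂ _+_ (cong₂ (λ s c → cyclesOfColour s c j) removeLast-σ restrict-c) (⟦no∧⟧ (lookup σ last ≟ last) last-moves _) ⟩
      cyclesOfColour σ' c' j + 0
    ≡⟨ trans (+-identityʳ _) (counts j) ⟩
      a j
    ∎
    where open ≡-Reasoning

module AddFixed {m k : ℕ} (σ' : Vec (Fin m) m) (c' : Vec (Fin k) m) (j : Fin k) where

  last = fromℕ m

  next : Fin m → Fin (suc m)
  next x = inject₁ (lookup σ' x)

  σ : Vec (Fin (suc m)) (suc m)
  σ = V.tabulate (extend next last)

  c : Vec (Fin k) (suc m)
  c = V.tabulate (extend (lookup c') j)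

  fixed : lookup σ last ≡ last
  fixed = lookup-extend-last next last

  removeLast-σ : removeLast σ ≡ σ'
  removeLast-σ = vec-ext pointwise
    where
    pointwise : ∀ x → lookup (removeLast σ) x ≡ lookup σ' x
    pointwise x rewrite lookup∘tabulate (λ y → squash (squash y (lookup σ last)) (lookup σ (inject₁ y))) x
                      | lookup-extend-inject next last x = extend-inject (λ y → y) _ (lookup σ' x)

  restrict-c : restrict c ≡ c'
  restrict-c = vec-ext (λ x → trans (lookup-restrict c x) (lookup-extend-inject (lookup c') _ x))

  injective : Inj σ' → Inj σ
  injective inj a b e with inject-or-last a | inject-or-last b
  ... | inj₁ (x , refl) | inj₁ (y , refl) =
    cong inject₁ (inj x y (inject₁-injective (trans (sym (lookup-extend-inject next _ x)) (trans e (lookup-extend-inject next _ y)))))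
  ... | inj₁ (x , refl) | inj₂ refl = ⊥-elim (inject≢last _ (trans (sym (lookup-extend-inject next _ x)) (trans e fixed)))
  ... | inj₂ refl | inj₁ (y , refl) = ⊥-elim (inject≢last _ (trans (sym (lookup-extend-inject next _ y)) (trans (sym e) fixed)))
  ... | inj₂ refl | inj₂ refl = refl

  c-last : lookup c last ≡ j
  c-last = lookup-extend-last (lookup c') j

  const : ConstOnCycles σ' c' → ConstOnCycles σ c
  const cst v with inject-or-last v
  ... | inj₂ refl rewrite fixed = refl
  ... | inj₁ (x , refl) rewrite lookup-extend-inject next last x | lookup-extend-inject (lookup c') j x
                              | lookup-extend-inject (lookup c') j (lookup σ' x) = cst x

  cycles : Inj σ' → ∀ j' → cyclesOfColour σ c j' ≡ cyclesOfColour σ' c' j' + ⟦ ⌊ j ≟ j' ⌋ ⟧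
  cycles inj j' = begin
      cyclesOfColour σ c j'
    ≡⟨ RemoveLast.cycles-removeLast σ (injective inj) c j' ⟩
      cyclesOfColour (removeLast σ) (restrict c) j' + ⟦ does (lookup σ last ≟ last) ∧ ⌊ lookup c last ≟ j' ⌋ ⟧
    ≡⟨ cong₂ _+_ (cong₂ (λ s c → cyclesOfColour s c j') removeLast-σ restrict-c)
                 (trans (⟦yes∧⟧ (lookup σ last ≟ last) fixed _) (cong (λ z → ⟦ ⌊ z ≟ j' ⌋ ⟧) c-last)) ⟩
      cyclesOfColour σ' c' j' + ⟦ ⌊ j ≟ j' ⌋ ⟧
    ∎
    where open ≡-Reasoning

-- Conversely, every structure on [m+1] arises from its restriction to [m]:
-- by InsertAfter if some point is mapped to the last one, by AddFixed otherwise.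
module Reconstruct {m k : ℕ} (σ : Vec (Fin (suc m)) (suc m)) (c : Vec (Fin k) (suc m))
                   (inj : Inj σ) (cst : ConstOnCycles σ c) where

  open RemoveLast σ inj using (last; step; cycles-removeLast)

  σ' = removeLast σ
  c' = restrict c

  -- If no point of [m] is mapped to the last point, the last point is fixed:
  -- the step before returning to it along its cycle cannot come from [m].
  fixed-last : (∀ i → ¬ lookup σ (inject₁ i) ≡ last) → lookup σ last ≡ last
  fixed-last ne with period σ inj last
  ... | suc q , _ , _ , back with inject-or-last (iter σ q last)
  ... | inj₁ (z , e) = ⊥-elim (ne z (trans (cong (lookup σ) (sym e)) back))
  ... | inj₂ e = trans (cong (lookup σ) (sym e)) back

  module _ (i : Fin m) (i↦last : lookup σ (inject₁ i) ≡ last) where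
    open InsertAfter σ' c' i using (next; next-i; next-other; c-last) renaming (σ to σI; c to cI)

    last-moves : ¬ lookup σ last ≡ last
    last-moves e = inject≢last i (inj _ _ (trans i↦last (sym e)))

    insertAfter-σ : σI ≡ σ
    insertAfter-σ = vec-ext pointwise
      where
      pointwise : ∀ v → lookup σI v ≡ lookup σ v
      pointwise v with inject-or-last v
      ... | inj₂ refl with step i
      ...   | inj₁ e₁ = ⊥-elim (inject≢last _ (trans (sym e₁) i↦last))
      ...   | inj₂ (_ , e₂) = trans (lookup-extend-last next _) (sym e₂)
      pointwise v | inj₁ (x , refl) with x ≟ i
      ... | yes refl = trans (lookup-extend-inject next _ x) (trans next-i (sym i↦last))
      ... | no x≢i with step x
      ...   | inj₁ e₁ = trans (lookup-extend-inject next _ x) (trans (next-other x x≢i) (sym e₁))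
      ...   | inj₂ (e₁ , _) = ⊥-elim (x≢i (inject₁-injective (inj _ _ (trans e₁ (sym i↦last)))))

    insertAfter-c : cI ≡ c
    insertAfter-c = vec-ext pointwise
      where
      pointwise : ∀ v → lookup cI v ≡ lookup c v
      pointwise v with inject-or-last v
      ... | inj₂ refl =
        trans c-last (trans (lookup-restrict c i) (trans (sym (cst (inject₁ i))) (cong (lookup c) i↦last)))
      ... | inj₁ (x , refl) = trans (lookup-extend-inject (lookup c') _ x) (lookup-restrict c x)

    profile-moving : ∀ a → Profile a σ c → Profile a σ' c'
    profile-moving a counts j = begin
        cyclesOfColour σ' c' j
      ≡⟨ sym (+-identityʳ _) ⟩
        cyclesOfColour σ' c' j + 0
      ≡⟨ cong (cyclesOfColour σ' c' j +_) (sym (⟦no∧⟧ (lookup σ last ≟ last) last-moves _)) ⟩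
        cyclesOfColour σ' c' j + ⟦ does (lookup σ last ≟ last) ∧ ⌊ lookup c last ≟ j ⌋ ⟧
      ≡⟨ sym (cycles-removeLast c j) ⟩
        cyclesOfColour σ c j
      ≡⟨ counts j ⟩
        a j
      ∎
      where open ≡-Reasoning

  module _ (fixed : lookup σ last ≡ last) where
    open AddFixed σ' c' (lookup c last) using (next; c-last) renaming (σ to σX; c to cX; fixed to fixedX)

    addFixed-σ : σX ≡ σ
    addFixed-σ = vec-ext pointwise
      where
      pointwise : ∀ v → lookup σX v ≡ lookup σ v
      pointwise v with inject-or-last v
      ... | inj₂ refl = trans fixedX (sym fixed)
      ... | inj₁ (x , refl) with step x
      ...   | inj₁ e₁ = trans (lookup-extend-inject next _ x) (sym e₁)
      ...   | inj₂ (e₁ , _) = ⊥-elim (inject≢last x (inj _ _ (trans e₁ (sym fixed))))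

    addFixed-c : cX ≡ c
    addFixed-c = vec-ext pointwise
      where
      pointwise : ∀ v → lookup cX v ≡ lookup c v
      pointwise v with inject-or-last v
      ... | inj₂ refl = c-last
      ... | inj₁ (x , refl) = trans (lookup-extend-inject (lookup c') _ x) (lookup-restrict c x)

    cycles-fixed : ∀ j → cyclesOfColour σ c j ≡ cyclesOfColour σ' c' j + ⟦ ⌊ lookup c last ≟ j ⌋ ⟧
    cycles-fixed j =
      trans (cycles-removeLast c j) (cong (cyclesOfColour σ' c' j +_) (⟦yes∧⟧ (lookup σ last ≟ last) fixed _))

structures : ∀ m k → List (Structure m k)
structures m k = cartesianProduct (allVecs (allFin m) m) (allVecs (allFin k) m)

_≟S_ : ∀ {m k} → DecidableEquality (Structure m k)
_≟S_ = decPair (≡-dec _≟_) (≡-dec _≟_)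

enum-structures : ∀ m k → Enumerates (_≟S_ {m} {k}) (structures m k)
enum-structures m k =
  enum-cart (≡-dec _≟_) (≡-dec _≟_) (allVecs (allFin m) m) (allVecs (allFin k) m)
    (enum-allVecs _≟_ (allFin m) (enum-allFin m) m) (enum-allVecs _≟_ (allFin k) (enum-allFin k) m)

numWithProfile : ∀ m k → (Fin k → ℕ) → ℕ
numWithProfile m k a = ∑ (structures m k) (λ y → ⟦ hasProfile a y ⟧)

decrement : ∀ {k} → (Fin k → ℕ) → Fin k → Fin k → ℕ
decrement a j j' = if ⌊ j ≟ j' ⌋ then a j' ∸ 1 else a j'

decrement-+ : ∀ {k} (a : Fin k → ℕ) j → 1 ≤ a j → ∀ j' → decrement a j j' + ⟦ ⌊ j ≟ j' ⌋ ⟧ ≡ a j'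
decrement-+ a j 1≤aj j' with j ≟ j'
... | yes refl = m∸n+n≡m 1≤aj
... | no _ = +-identityʳ _

decrement-inverse : ∀ {k} (a b : Fin k → ℕ) j → (∀ j' → a j' ≡ b j' + ⟦ ⌊ j ≟ j' ⌋ ⟧) →
  1 ≤ a j × (∀ j' → b j' ≡ decrement a j j')
decrement-inverse a b j split = positive (j ≟ j) (split j) , undo
  where
  positive : (d : Dec (j ≡ j)) → a j ≡ b j + ⟦ ⌊ d ⌋ ⟧ → 1 ≤ a j
  positive (yes _) e = subst (1 ≤_) (sym (trans e (+-comm (b j) 1))) (s≤s z≤n)
  positive (no j≢j) _ = ⊥-elim (j≢j refl)
  undo : ∀ j' → b j' ≡ decrement a j j'
  undo j' with j ≟ j' | split j'
  ... | yes _ | e = trans (sym (m+n∸n≡m (b j') 1)) (cong (_∸ 1) (sym e))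
  ... | no _ | e = trans (sym (+-identityʳ (b j'))) (sym e)

-- The recurrence N(m+1,a) = m·N(m,a) + Σⱼ [aⱼ ≥ 1]·N(m, a - eⱼ), obtained
-- from a correspondence between structures on [m+1] with profile a and
-- "decompositions": either a structure on [m] with profile a together with
-- a point i after which the last point is inserted, or a colour j together
-- with a structure on [m] of profile a - eⱼ (the last point a fixed point
-- of colour j).
module Recurrence {m k : ℕ} (a : Fin k → ℕ) where

  Decomposition : Set
  Decomposition = (Structure m k × Fin m) ⊎ (Fin k × Structure m k)

  decompositions : List Decomposition
  decompositions = map inj₁ (cartesianProduct (structures m k) (allFin m))
                ++ map inj₂ (cartesianProduct (allFin k) (structures m k))

  _≟D_ : DecidableEquality Decomposition
  _≟D_ = decSum (decPair _≟S_ _≟_) (decPair _≟_ _≟S_)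

  enum-decompositions : Enumerates _≟D_ decompositions
  enum-decompositions =
    enum-sum (decPair _≟S_ _≟_) (decPair _≟_ _≟S_)
      (cartesianProduct (structures m k) (allFin m)) (cartesianProduct (allFin k) (structures m k))
      (enum-cart _≟S_ _≟_ (structures m k) (allFin m) (enum-structures m k) (enum-allFin m))
      (enum-cart _≟_ _≟S_ (allFin k) (structures m k) (enum-allFin k) (enum-structures m k))

  valid : Decomposition → Bool
  valid (inj₁ (y , i)) = hasProfile a y
  valid (inj₂ (j , y)) = (1 ≤ᵇ a j) ∧ hasProfile (decrement a j) y

  build : Decomposition → Structure (suc m) k
  build (inj₁ ((σ' , c') , i)) = InsertAfter.σ σ' c' i , InsertAfter.c σ' c' i
  build (inj₂ (j , (σ' , c'))) = AddFixed.σ σ' c' j , AddFixed.c σ' c' j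

  decomposeBy : (σ : Vec (Fin (suc m)) (suc m)) (c : Vec (Fin k) (suc m)) →
    Dec (∃ λ i → lookup σ (inject₁ i) ≡ fromℕ m) → Decomposition
  decomposeBy σ c (yes (i , _)) = inj₁ ((removeLast σ , restrict c) , i)
  decomposeBy σ c (no _) = inj₂ (lookup c (fromℕ m) , (removeLast σ , restrict c))

  decompose : Structure (suc m) k → Decomposition
  decompose (σ , c) = decomposeBy σ c (any? (λ i → lookup σ (inject₁ i) ≟ fromℕ m))

  build-valid : ∀ x → valid x ≡ true → hasProfile a (build x) ≡ true
  build-valid (inj₁ ((σ' , c') , i)) h with hasProfile⁻ a σ' c' h
  ... | inj , cst , counts = hasProfile⁺ a σ c (injective inj) (const cst) (profile a inj counts)
    where open InsertAfter σ' c' i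
  build-valid (inj₂ (j , (σ' , c'))) h with ∧-true h
  ... | 1≤aj , h' with hasProfile⁻ (decrement a j) σ' c' h'
  ... | inj , cst , counts = hasProfile⁺ a σ c (injective inj) (const cst) counts'
    where
    open AddFixed σ' c' j
    counts' : ∀ j' → cyclesOfColour σ c j' ≡ a j'
    counts' j' = trans (cycles inj j') (trans (cong (_+ ⟦ ⌊ j ≟ j' ⌋ ⟧) (counts j')) (decrement-+ a j (≤ᵇ-true⁻ 1≤aj) j'))

  decompose-build : ∀ x → valid x ≡ true → decompose (build x) ≡ x
  decompose-build (inj₁ ((σ' , c') , i)) _ with any? (λ i' → lookup (InsertAfter.σ σ' c' i) (inject₁ i') ≟ fromℕ m)
  ... | yes (i' , e) with i' ≟ i
  ... | yes refl = cong₂ (λ s c → inj₁ ((s , c) , i)) removeLast-σ restrict-c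
    where open InsertAfter σ' c' i
  ... | no i'≢i = ⊥-elim (inject≢last _ (trans (sym (next-other i' i'≢i)) (trans (sym (lookup-extend-inject next _ i')) e)))
    where open InsertAfter σ' c' i
  decompose-build (inj₁ ((σ' , c') , i)) _ | no none =
    ⊥-elim (none (i , trans (lookup-extend-inject next _ i) next-i))
    where open InsertAfter σ' c' i
  decompose-build (inj₂ (j , (σ' , c'))) _ with any? (λ i' → lookup (AddFixed.σ σ' c' j) (inject₁ i') ≟ fromℕ m)
  ... | yes (i' , e) = ⊥-elim (inject≢last _ (trans (sym (lookup-extend-inject next _ i')) e))
    where open AddFixed σ' c' j
  ... | no _ = cong₂ (λ x y → inj₂ (x , y)) c-last (cong₂ _,_ removeLast-σ restrict-c)
    where open AddFixed σ' c' j

  decomposeBy-valid : ∀ σ c → Inj σ → (cst : ConstOnCycles σ c) → Profile a σ c →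
    (d : Dec (∃ λ i → lookup σ (inject₁ i) ≡ fromℕ m)) → valid (decomposeBy σ c d) ≡ true
  decomposeBy-valid σ c inj cst counts (yes (i , i↦last)) =
    hasProfile⁺ a (removeLast σ) (restrict c) (RemoveLast.injective σ inj) (RemoveLast.const σ inj c cst)
      (profile-moving i i↦last a counts)
    where open Reconstruct σ c inj cst
  decomposeBy-valid σ c inj cst counts (no none) =
    ∧-intro (≤ᵇ-true⁺ (proj₁ split))
      (hasProfile⁺ (decrement a (lookup c (fromℕ m))) (removeLast σ) (restrict c)
        (RemoveLast.injective σ inj) (RemoveLast.const σ inj c cst) (proj₂ split))
    where
    open Reconstruct σ c inj cst
    split = decrement-inverse a (λ j → cyclesOfColour (removeLast σ) (restrict c) j) (lookup c (fromℕ m))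
              (λ j → trans (sym (counts j)) (cycles-fixed (fixed-last (λ i e → none (i , e))) j))

  decompose-valid : ∀ y → hasProfile a y ≡ true → valid (decompose y) ≡ true
  decompose-valid (σ , c) h =
    decomposeBy-valid σ c (proj₁ facts) (proj₁ (proj₂ facts)) (proj₂ (proj₂ facts)) (any? (λ i → lookup σ (inject₁ i) ≟ fromℕ m))
    where facts = hasProfile⁻ a σ c h

  build-decomposeBy : ∀ σ c → Inj σ → ConstOnCycles σ c →
    (d : Dec (∃ λ i → lookup σ (inject₁ i) ≡ fromℕ m)) → build (decomposeBy σ c d) ≡ (σ , c)
  build-decomposeBy σ c inj cst (yes (i , i↦last)) = cong₂ _,_ (insertAfter-σ i i↦last) (insertAfter-c i i↦last)
    where open Reconstruct σ c inj cst
  build-decomposeBy σ c inj cst (no none) = cong₂ _,_ (addFixed-σ fixed) (addFixed-c fixed)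
    where
    open Reconstruct σ c inj cst
    fixed = fixed-last (λ i e → none (i , e))

  build-decompose : ∀ y → hasProfile a y ≡ true → build (decompose y) ≡ y
  build-decompose (σ , c) h =
    build-decomposeBy σ c (proj₁ facts) (proj₁ (proj₂ facts)) (any? (λ i → lookup σ (inject₁ i) ≟ fromℕ m))
    where facts = hasProfile⁻ a σ c h

  correspondence : Correspondence (hasProfile a) valid
  correspondence = record
    { to = build ; from = decompose
    ; to-P = build-valid ; from-Q = decompose-valid
    ; from-to = decompose-build ; to-from = build-decompose }

  recurrence : numWithProfile (suc m) k a
             ≡ m * numWithProfile m k a + ∑F (λ j → ⟦ 1 ≤ᵇ a j ⟧ * numWithProfile m k (decrement a j))
  recurrence =
    trans (count-correspondence _≟S_ _≟D_ (structures (suc m) k) decompositions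
             (enum-structures (suc m) k) enum-decompositions correspondence)
      (trans (∑-++ (map inj₁ (cartesianProduct (structures m k) (allFin m)))
                   (map inj₂ (cartesianProduct (allFin k) (structures m k))) (λ x → ⟦ valid x ⟧))
             (cong₂ _+_ insertions fixedPoints))
    where
    open ≡-Reasoning
    insertions : ∑ (map inj₁ (cartesianProduct (structures m k) (allFin m))) (λ x → ⟦ valid x ⟧) ≡ m * numWithProfile m k a
    insertions = begin
        ∑ (map inj₁ (cartesianProduct (structures m k) (allFin m))) (λ x → ⟦ valid x ⟧)
      ≡⟨ ∑-map inj₁ (cartesianProduct (structures m k) (allFin m)) (λ x → ⟦ valid x ⟧) ⟩
        ∑ (cartesianProduct (structures m k) (allFin m)) (λ z → ⟦ hasProfile a (proj₁ z) ⟧)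
      ≡⟨ ∑-cart (structures m k) (allFin m) (λ z → ⟦ hasProfile a (proj₁ z) ⟧) ⟩
        ∑ (structures m k) (λ y → ∑ (allFin m) (λ _ → ⟦ hasProfile a y ⟧))
      ≡⟨ ∑-cong (structures m k) (λ y → trans (∑-allFin {m} _) (∑F-const {m} _)) ⟩
        ∑ (structures m k) (λ y → m * ⟦ hasProfile a y ⟧)
      ≡⟨ ∑-*ˡ m (structures m k) _ ⟩
        m * numWithProfile m k a
      ∎
    fixedPoints : ∑ (map inj₂ (cartesianProduct (allFin k) (structures m k))) (λ x → ⟦ valid x ⟧)
                ≡ ∑F (λ j → ⟦ 1 ≤ᵇ a j ⟧ * numWithProfile m k (decrement a j))
    fixedPoints = begin
        ∑ (map inj₂ (cartesianProduct (allFin k) (structures m k))) (λ x → ⟦ valid x ⟧)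
      ≡⟨ ∑-map inj₂ (cartesianProduct (allFin k) (structures m k)) (λ x → ⟦ valid x ⟧) ⟩
        ∑ (cartesianProduct (allFin k) (structures m k)) (λ z → ⟦ valid (inj₂ z) ⟧)
      ≡⟨ ∑-cart (allFin k) (structures m k) (λ z → ⟦ valid (inj₂ z) ⟧) ⟩
        ∑ (allFin k) (λ j → ∑ (structures m k) (λ y → ⟦ (1 ≤ᵇ a j) ∧ hasProfile (decrement a j) y ⟧))
      ≡⟨ ∑-allFin (λ j → ∑ (structures m k) (λ y → ⟦ (1 ≤ᵇ a j) ∧ hasProfile (decrement a j) y ⟧)) ⟩
        ∑F (λ j → ∑ (structures m k) (λ y → ⟦ (1 ≤ᵇ a j) ∧ hasProfile (decrement a j) y ⟧))
      ≡⟨ ∑F-cong (λ j → trans (∑-cong (structures m k) (λ y → ⟦∧⟧ (1 ≤ᵇ a j) _)) (∑-*ˡ ⟦ 1 ≤ᵇ a j ⟧ (structures m k) _)) ⟩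
        ∑F (λ j → ⟦ 1 ≤ᵇ a j ⟧ * numWithProfile m k (decrement a j))
      ∎

sumBelow : ℕ → (ℕ → ℕ) → ℕ
sumBelow zero f = 0
sumBelow (suc n) f = f 0 + sumBelow n (λ i → f (suc i))

sum-upTo : ∀ f n → sum (map f (upTo n)) ≡ sumBelow n f
sum-upTo f n = trans (cong sum (map-applyUpTo (λ x → x) f n)) (go f n)
  where
  go : ∀ g n → sum (applyUpTo g n) ≡ sumBelow n g
  go g zero = refl
  go g (suc n) = cong (g 0 +_) (go (λ i → g (suc i)) n)

sumBelow-last : ∀ f n → sumBelow (suc n) f ≡ sumBelow n f + f n
sumBelow-last f zero = +-comm (f 0) 0
sumBelow-last f (suc n) = trans (cong (f 0 +_) (sumBelow-last (λ i → f (suc i)) n)) (sym (+-assoc (f 0) _ _))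

sumBelow-cong : ∀ {f g} n → (∀ i → i < n → f i ≡ g i) → sumBelow n f ≡ sumBelow n g
sumBelow-cong zero h = refl
sumBelow-cong (suc n) h = cong₂ _+_ (h 0 (s≤s z≤n)) (sumBelow-cong n (λ i i<n → h (suc i) (s≤s i<n)))

sumBelow-+ : ∀ f g n → sumBelow n (λ i → f i + g i) ≡ sumBelow n f + sumBelow n g
sumBelow-+ f g zero = refl
sumBelow-+ f g (suc n) =
  trans (cong (f 0 + g 0 +_) (sumBelow-+ (λ i → f (suc i)) (λ i → g (suc i)) n)) (interchange (f 0) (g 0) _ _)
  where
  interchange : ∀ a b x y → a + b + (x + y) ≡ a + x + (b + y)
  interchange = solve-∀

sumBelow-*ˡ : ∀ k f n → sumBelow n (λ i → k * f i) ≡ k * sumBelow n f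
sumBelow-*ˡ k f zero = sym (*-zeroʳ k)
sumBelow-*ˡ k f (suc n) = trans (cong (k * f 0 +_) (sumBelow-*ˡ k (λ i → f (suc i)) n)) (sym (*-distribˡ-+ k (f 0) _))

sumBelow-0 : ∀ n → sumBelow n (λ _ → 0) ≡ 0
sumBelow-0 zero = refl
sumBelow-0 (suc n) = sumBelow-0 n

stirling : ℕ → ℕ → ℕ
stirling zero zero = 1
stirling zero (suc s) = 0
stirling (suc m) zero = 0
stirling (suc m) (suc s) = m * stirling m (suc s) + stirling m s

stirlingPred : ℕ → ℕ → ℕ
stirlingPred m zero = 0
stirlingPred m (suc s) = stirling m s

stirling-suc : ∀ m s → stirling (suc m) s ≡ m * stirling m s + stirlingPred m s
stirling-suc zero zero = refl
stirling-suc (suc m) zero = sym (trans (+-identityʳ _) (*-zeroʳ (suc m)))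
stirling-suc m (suc s) = refl

-- The sum Σ_{i<n} C(n,i+1)·i!·c(n-i-1,s): choose the i+1 points of a marked
-- cycle, arrange them cyclically, and decompose the rest into s cycles.
markedCycleTerm : ℕ → ℕ → ℕ → ℕ
markedCycleTerm n s i = (n C suc i) * (i !) * stirling (n ∸ suc i) s

markedCycleSum : ℕ → ℕ → ℕ
markedCycleSum n s = sumBelow n (markedCycleTerm n s)

markedCycleSumPred : ℕ → ℕ → ℕ
markedCycleSumPred n s = sumBelow n (λ i → (n C suc i) * (i !) * stirlingPred (n ∸ suc i) s)

-- Pascal's rule C(n+1,i+1) = C(n,i) + C(n,i+1) splits the sum for n+1;
-- the term C(n,n+1) vanishes.
markedCycleSum-pascal : ∀ n s → markedCycleSum (suc n) s
  ≡ sumBelow (suc n) (λ i → (n C i) * (i !) * stirling (n ∸ i) s)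
    + sumBelow n (λ i → (n C suc i) * (i !) * stirling (n ∸ i) s)
markedCycleSum-pascal n s = begin
    markedCycleSum (suc n) s
  ≡⟨ sumBelow-cong (suc n) (λ i _ → cong (λ z → z * (i !) * stirling (n ∸ i) s) (sym (nCk+nC[k+1]≡[n+1]C[k+1] n i))) ⟩
    sumBelow (suc n) (λ i → (n C i + n C suc i) * (i !) * stirling (n ∸ i) s)
  ≡⟨ sumBelow-cong (suc n) (λ i _ → distrib (n C i) (n C suc i) (i !) (stirling (n ∸ i) s)) ⟩
    sumBelow (suc n) (λ i → (n C i) * (i !) * stirling (n ∸ i) s + (n C suc i) * (i !) * stirling (n ∸ i) s)
  ≡⟨ sumBelow-+ lower upper (suc n) ⟩
    sumBelow (suc n) (λ i → (n C i) * (i !) * stirling (n ∸ i) s)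
      + sumBelow (suc n) (λ i → (n C suc i) * (i !) * stirling (n ∸ i) s)
  ≡⟨ cong (sumBelow (suc n) (λ i → (n C i) * (i !) * stirling (n ∸ i) s) +_)
          (trans (sumBelow-last upper n) (trans (cong (sumBelow n upper +_) lastVanishes) (+-identityʳ _))) ⟩
    sumBelow (suc n) (λ i → (n C i) * (i !) * stirling (n ∸ i) s)
      + sumBelow n (λ i → (n C suc i) * (i !) * stirling (n ∸ i) s)
  ∎
  where
  open ≡-Reasoning
  lower upper : ℕ → ℕ
  lower i = (n C i) * (i !) * stirling (n ∸ i) s
  upper i = (n C suc i) * (i !) * stirling (n ∸ i) s
  distrib : ∀ a b x y → (a + b) * x * y ≡ a * x * y + b * x * y
  distrib = solve-∀
  lastVanishes : (n C suc n) * (n !) * stirling (n ∸ n) s ≡ 0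
  lastVanishes rewrite k>n⇒nCk≡0 {n} {suc n} (s≤s ≤-refl) = refl

stirling-step-term : ∀ n s i → i < n → (n C suc i) * (i !) * stirling (n ∸ i) s
  ≡ (n ∸ suc i) * markedCycleTerm n s i + (n C suc i) * (i !) * stirlingPred (n ∸ suc i) s
stirling-step-term n s i i<n = begin
    (n C suc i) * (i !) * stirling (n ∸ i) s
  ≡⟨ cong (λ z → (n C suc i) * (i !) * stirling z s) (+-∸-assoc 1 {n} {suc i} i<n) ⟩
    (n C suc i) * (i !) * stirling (suc (n ∸ suc i)) s
  ≡⟨ cong ((n C suc i) * (i !) *_) (stirling-suc (n ∸ suc i) s) ⟩
    (n C suc i) * (i !) * ((n ∸ suc i) * stirling (n ∸ suc i) s + stirlingPred (n ∸ suc i) s)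
  ≡⟨ rearrange (n C suc i) (i !) (n ∸ suc i) (stirling (n ∸ suc i) s) (stirlingPred (n ∸ suc i) s) ⟩
    (n ∸ suc i) * markedCycleTerm n s i + (n C suc i) * (i !) * stirlingPred (n ∸ suc i) s
  ∎
  where
  open ≡-Reasoning
  rearrange : ∀ a b d x y → a * b * (d * x + y) ≡ d * (a * b * x) + a * b * y
  rearrange = solve-∀

-- A term with (i+1)! and one with n-i-1 copies of i! add up to n copies.
factorial-merge : ∀ n s i → i < n →
  (n C suc i) * (suc i !) * stirling (n ∸ suc i) s + (n ∸ suc i) * markedCycleTerm n s i ≡ n * markedCycleTerm n s i
factorial-merge n s i i<n = begin
    (n C suc i) * (suc i !) * stirling (n ∸ suc i) s + (n ∸ suc i) * markedCycleTerm n s i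
  ≡⟨ collect (n C suc i) (i !) i (n ∸ suc i) (stirling (n ∸ suc i) s) ⟩
    (suc i + (n ∸ suc i)) * markedCycleTerm n s i
  ≡⟨ cong (_* markedCycleTerm n s i) (m+[n∸m]≡n i<n) ⟩
    n * markedCycleTerm n s i
  ∎
  where
  open ≡-Reasoning
  collect : ∀ a f i d x → a * (f + i * f) * x + d * (a * f * x) ≡ (suc i + d) * (a * f * x)
  collect = solve-∀

markedCycleSum-closed : ∀ n s → markedCycleSum n s ≡ suc s * stirling n (suc s)
markedCycleSumPred-closed : ∀ n s → markedCycleSumPred n s ≡ s * stirling n s

markedCycleSum-closed zero s = sym (*-zeroʳ s)
markedCycleSum-closed (suc n) s = begin
    markedCycleSum (suc n) s
  ≡⟨ markedCycleSum-pascal n s ⟩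
    (1 * 1 * stirling n s + sumBelow n (λ i → (n C suc i) * (suc i !) * stirling (n ∸ suc i) s))
      + sumBelow n (λ i → (n C suc i) * (i !) * stirling (n ∸ i) s)
  ≡⟨ cong (1 * 1 * stirling n s + sumBelow n shifted +_)
          (trans (sumBelow-cong n (stirling-step-term n s)) (sumBelow-+ weighted predTerm n)) ⟩
    (1 * 1 * stirling n s + sumBelow n (λ i → (n C suc i) * (suc i !) * stirling (n ∸ suc i) s))
      + (sumBelow n (λ i → (n ∸ suc i) * markedCycleTerm n s i) + markedCycleSumPred n s)
  ≡⟨ regroup (stirling n s) _ _ (markedCycleSumPred n s) ⟩
    stirling n s + (sumBelow n (λ i → (n C suc i) * (suc i !) * stirling (n ∸ suc i) s)
      + sumBelow n (λ i → (n ∸ suc i) * markedCycleTerm n s i)) + markedCycleSumPred n s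
  ≡⟨ cong (λ z → stirling n s + z + markedCycleSumPred n s)
          (trans (sym (sumBelow-+ shifted weighted n))
            (trans (sumBelow-cong n (factorial-merge n s)) (sumBelow-*ˡ n (markedCycleTerm n s) n))) ⟩
    stirling n s + n * markedCycleSum n s + markedCycleSumPred n s
  ≡⟨ cong₂ (λ x y → stirling n s + n * x + y) (markedCycleSum-closed n s) (markedCycleSumPred-closed n s) ⟩
    stirling n s + n * (suc s * stirling n (suc s)) + s * stirling n s
  ≡⟨ factor (stirling n s) n s (stirling n (suc s)) ⟩
    suc s * (n * stirling n (suc s) + stirling n s)
  ∎
  where
  open ≡-Reasoning
  shifted weighted predTerm : ℕ → ℕ
  shifted i = (n C suc i) * (suc i !) * stirling (n ∸ suc i) s
  weighted i = (n ∸ suc i) * markedCycleTerm n s i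
  predTerm i = (n C suc i) * (i !) * stirlingPred (n ∸ suc i) s
  regroup : ∀ a x y z → (1 * 1 * a + x) + (y + z) ≡ a + (x + y) + z
  regroup = solve-∀
  factor : ∀ a n s b → a + n * (suc s * b) + s * a ≡ suc s * (n * b + a)
  factor = solve-∀

markedCycleSumPred-closed n zero =
  trans (sumBelow-cong n (λ i _ → *-zeroʳ ((n C suc i) * (i !)))) (sumBelow-0 n)
markedCycleSumPred-closed n (suc s) = markedCycleSum-closed n s

decrement-suc : ∀ {k} (a : Fin (suc k) → ℕ) j x → decrement a (F.suc j) (F.suc x) ≡ decrement (λ y → a (F.suc y)) j x
decrement-suc a j x with j ≟ x
... | yes refl = refl
... | no _ = refl

∑-decrement : ∀ {k} (a : Fin k → ℕ) j → 1 ≤ a j → ∑F (decrement a j) + 1 ≡ ∑F a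
∑-decrement {suc k} a F.zero 1≤a with a F.zero
... | suc v = trans (+-assoc v _ 1) (trans (cong (v +_) (+-comm _ 1)) (+-suc v _))
∑-decrement {suc k} a (F.suc j) 1≤a =
  trans (+-assoc (a F.zero) _ 1)
    (cong (a F.zero +_) (trans (cong (_+ 1) (∑F-cong (decrement-suc a j))) (∑-decrement (λ y → a (F.suc y)) j 1≤a)))

∏!-decrement : ∀ {k} (a : Fin k → ℕ) j → 1 ≤ a j → ∏F (λ x → a x !) ≡ a j * ∏F (λ x → decrement a j x !)
∏!-decrement {suc k} a F.zero 1≤a with a F.zero
... | suc v = *-assoc (suc v) (v !) _
∏!-decrement {suc k} a (F.suc j) 1≤a =
  trans (cong (a F.zero ! *_) (∏!-decrement (λ y → a (F.suc y)) j 1≤a))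
    (trans (swap (a F.zero !) (a (F.suc j)) _)
      (cong (a (F.suc j) *_) (cong (a F.zero ! *_) (∏F-cong (λ x → cong _! (sym (decrement-suc a j x)))))))
  where
  swap : ∀ x y z → x * (y * z) ≡ y * (x * z)
  swap = solve-∀

-- The closed form  N(m,a)·∏ aⱼ! = s!·c(m,s)  with s = Σ aⱼ: numbering the
-- cycles inside each colour class turns a structure of profile a into a
-- permutation with s cycles together with a labelling of its cycles by [s].
ClosedForm : ℕ → ℕ → Set
ClosedForm m k = ∀ (a : Fin k → ℕ) → numWithProfile m k a * ∏F (λ j → a j !) ≡ (∑F a) ! * stirling m (∑F a)

-- On [0] only the empty structure exists, of the zero profile.
closedForm-zero : ∀ k → ClosedForm 0 k
closedForm-zero k a with all (λ j → 0 ≡ᵇ a j) (allFin k) in allZero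
... | true = begin
    1 * ∏F (λ j → a j !)
  ≡⟨ trans (+-identityʳ _) (∏F-cong (λ j → cong _! (zero-at j))) ⟩
    ∏F {k} (λ _ → 1)
  ≡⟨ ∏F-1 {k} ⟩
    1
  ≡⟨ cong (λ s → s ! * stirling 0 s) (sym (∑F-zero⁺ a zero-at)) ⟩
    (∑F a) ! * stirling 0 (∑F a)
  ∎
  where
  open ≡-Reasoning
  zero-at : ∀ j → a j ≡ 0
  zero-at j = sym (≡ᵇ-true⁻ (all-allFin⁻ _ allZero j))
... | false with ∑F a in sum≡
... | zero with trans (sym (all-allFin⁺ _ (λ j → ≡ᵇ-true⁺ (sym (∑F-zero⁻ a sum≡ j))))) allZero
... | ()
closedForm-zero k a | false | suc s = sym (*-zeroʳ (suc s !))

stirling-factorial-step : ∀ m s → m * (s ! * stirling m s) + s * ((s ∸ 1) ! * stirling m (s ∸ 1)) ≡ s ! * stirling (suc m) s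
stirling-factorial-step zero zero = refl
stirling-factorial-step (suc m) zero = cong (_+ 0) (*-zeroʳ (suc m))
stirling-factorial-step m (suc s) = expand m (s !) s (stirling m (suc s)) (stirling m s)
  where
  expand : ∀ m f s x y → m * ((f + s * f) * x) + suc s * (f * y) ≡ (f + s * f) * (m * x + y)
  expand = solve-∀

fixedPointTerm : ∀ m k → ClosedForm m k → (a : Fin k → ℕ) → ∀ j →
  ⟦ 1 ≤ᵇ a j ⟧ * numWithProfile m k (decrement a j) * ∏F (λ x → a x !)
    ≡ a j * ((∑F a ∸ 1) ! * stirling m (∑F a ∸ 1))
fixedPointTerm m k closed a j with a j in aj≡
... | zero = refl
... | suc v = begin
    (N' + 0) * ∏F (λ x → a x !)
  ≡⟨ cong (_* ∏F (λ x → a x !)) (+-identityʳ N') ⟩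
    N' * ∏F (λ x → a x !)
  ≡⟨ cong (N' *_) (trans (∏!-decrement a j 1≤aj) (cong (_* ∏F (λ x → decrement a j x !)) aj≡)) ⟩
    N' * (suc v * ∏F (λ x → decrement a j x !))
  ≡⟨ swap N' (suc v) _ ⟩
    suc v * (N' * ∏F (λ x → decrement a j x !))
  ≡⟨ cong (suc v *_) (closed (decrement a j)) ⟩
    suc v * ((∑F (decrement a j)) ! * stirling m (∑F (decrement a j)))
  ≡⟨ cong (λ z → suc v * (z ! * stirling m z)) sum-decrement ⟩
    suc v * ((∑F a ∸ 1) ! * stirling m (∑F a ∸ 1))
  ∎
  where
  open ≡-Reasoning
  N' = numWithProfile m k (decrement a j)
  1≤aj : 1 ≤ a j
  1≤aj = subst (1 ≤_) (sym aj≡) (s≤s z≤n)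
  sum-decrement : ∑F (decrement a j) ≡ ∑F a ∸ 1
  sum-decrement = sym (trans (cong (_∸ 1) (sym (∑-decrement a j 1≤aj))) (m+n∸n≡m _ 1))
  swap : ∀ x y z → x * (y * z) ≡ y * (x * z)
  swap = solve-∀

closedForm : ∀ m k → ClosedForm m k
closedForm zero k = closedForm-zero k
closedForm (suc m) k a = begin
    numWithProfile (suc m) k a * P
  ≡⟨ cong (_* P) (Recurrence.recurrence {m} {k} a) ⟩
    (m * numWithProfile m k a + ∑F fixedPoints) * P
  ≡⟨ *-distribʳ-+ P (m * numWithProfile m k a) (∑F fixedPoints) ⟩
    m * numWithProfile m k a * P + ∑F fixedPoints * P
  ≡⟨ cong₂ _+_ (trans (*-assoc m _ P) (cong (m *_) (closedForm m k a))) (sym (∑F-*ʳ fixedPoints P)) ⟩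
    m * (S ! * stirling m S) + ∑F (λ j → fixedPoints j * P)
  ≡⟨ cong (m * (S ! * stirling m S) +_) (trans (∑F-cong (fixedPointTerm m k (closedForm m k) a)) (∑F-*ʳ a _)) ⟩
    m * (S ! * stirling m S) + S * ((S ∸ 1) ! * stirling m (S ∸ 1))
  ≡⟨ stirling-factorial-step m S ⟩
    S ! * stirling (suc m) S
  ∎
  where
  open ≡-Reasoning
  P = ∏F (λ j → a j !)
  S = ∑F a
  fixedPoints : Fin k → ℕ
  fixedPoints j = ⟦ 1 ≤ᵇ a j ⟧ * numWithProfile m k (decrement a j)

mixedProfile : ∀ {k} → ℕ → Fin k → ℕ
mixedProfile t j = if toℕ j ≡ᵇ 0 then t else 1

all-cong : ∀ {A : Set} {p q : A → Bool} (xs : List A) → (∀ x → p x ≡ q x) → all p xs ≡ all q xs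
all-cong [] h = refl
all-cong (x ∷ xs) h = cong₂ _∧_ (h x) (all-cong xs h)

mixedStirling≡numWithProfile : ∀ m k t → mixedStirling m k t ≡ numWithProfile m k (mixedProfile t)
mixedStirling≡numWithProfile m k t =
  trans (length-filter _ (structures m k)) (∑-cong (structures m k) sameTest)
  where
  sameTest : ∀ p → ⟦ isMixedColoured t p ⟧ ≡ ⟦ hasProfile (mixedProfile t) p ⟧
  sameTest (σ , c) = cong (λ b → ⟦ isInjective σ ∧ (isConst σ c ∧ b) ⟧) (all-cong (allFin k) sameCount)
    where
    sameCount : ∀ j → (if toℕ j ≡ᵇ 0 then cyclesOfColour σ c j ≡ᵇ t else cyclesOfColour σ c j ≡ᵇ 1)
                    ≡ (cyclesOfColour σ c j ≡ᵇ mixedProfile t j)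
    sameCount j with toℕ j ≡ᵇ 0
    ... | true = refl
    ... | false = refl

mixedStirling-closed : ∀ m k t → mixedStirling m (suc k) t * t ! ≡ (t + k) ! * stirling m (t + k)
mixedStirling-closed m k t = begin
    mixedStirling m (suc k) t * t !
  ≡⟨ cong₂ _*_ (mixedStirling≡numWithProfile m (suc k) t) (sym product) ⟩
    numWithProfile m (suc k) (mixedProfile t) * ∏F (λ j → mixedProfile {suc k} t j !)
  ≡⟨ closedForm m (suc k) (mixedProfile t) ⟩
    (∑F (mixedProfile {suc k} t)) ! * stirling m (∑F (mixedProfile {suc k} t))
  ≡⟨ cong (λ s → s ! * stirling m s) (cong (t +_) (trans (∑F-const {k} 1) (*-identityʳ k))) ⟩
    (t + k) ! * stirling m (t + k)
  ∎
  where
  open ≡-Reasoning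
  product : ∏F (λ j → mixedProfile {suc k} t j !) ≡ t !
  product = trans (cong (t ! *_) (∏F-1 {k})) (*-identityʳ (t !))

markedCycleTerm-mixed : ∀ n k t i →
  (t + k) ! * markedCycleTerm n (t + k) i ≡ (n C suc i) * (i !) * mixedStirling (n ∸ suc i) (suc k) t * t !
markedCycleTerm-mixed n k t i = begin
    (t + k) ! * ((n C suc i) * (i !) * stirling (n ∸ suc i) (t + k))
  ≡⟨ swap ((t + k) !) (n C suc i) (i !) (stirling (n ∸ suc i) (t + k)) ⟩
    (n C suc i) * (i !) * ((t + k) ! * stirling (n ∸ suc i) (t + k))
  ≡⟨ cong ((n C suc i) * (i !) *_) (sym (mixedStirling-closed (n ∸ suc i) k t)) ⟩
    (n C suc i) * (i !) * (mixedStirling (n ∸ suc i) (suc k) t * t !)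
  ≡⟨ sym (*-assoc ((n C suc i) * (i !)) _ (t !)) ⟩
    (n C suc i) * (i !) * mixedStirling (n ∸ suc i) (suc k) t * t !
  ∎
  where
  open ≡-Reasoning
  swap : ∀ a b d x → a * (b * d * x) ≡ b * d * (a * x)
  swap = solve-∀

factorial-suc : ∀ s x → suc s ! * x ≡ s ! * (suc s * x)
factorial-suc s x = rearrange (s !) x s
  where
  rearrange : ∀ f x s → (f + s * f) * x ≡ f * (suc s * x)
  rearrange = solve-∀

mainTheorem10 : (n k t : ℕ) → 1 ≤ n → 2 ≤ k → k ≤ n → 1 ≤ t → t ≤ n →
    mixedStirling n k t
      ≡ sum (map (λ i → (n C suc i) * (i !) * mixedStirling (n ∸ suc i) (k ∸ 1) t) (upTo n))
mainTheorem10 n zero t _ () _ _ _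
mainTheorem10 n (suc zero) t _ (s≤s ()) _ _ _
mainTheorem10 n (suc (suc k)) t _ _ _ _ _ = *-cancelʳ-≡ _ _ (t !) {{t !≢0}} (begin
    mixedStirling n (suc (suc k)) t * t !
  ≡⟨ mixedStirling-closed n (suc k) t ⟩
    (t + suc k) ! * stirling n (t + suc k)
  ≡⟨ cong (λ z → z ! * stirling n z) (+-suc t k) ⟩
    suc (t + k) ! * stirling n (suc (t + k))
  ≡⟨ factorial-suc (t + k) _ ⟩
    (t + k) ! * (suc (t + k) * stirling n (suc (t + k)))
  ≡⟨ cong ((t + k) ! *_) (sym (markedCycleSum-closed n (t + k))) ⟩
    (t + k) ! * markedCycleSum n (t + k)
  ≡⟨ sym (sumBelow-*ˡ ((t + k) !) (markedCycleTerm n (t + k)) n) ⟩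
    sumBelow n (λ i → (t + k) ! * markedCycleTerm n (t + k) i)
  ≡⟨ sumBelow-cong n (λ i _ → trans (markedCycleTerm-mixed n k t i) (*-comm _ (t !))) ⟩
    sumBelow n (λ i → t ! * ((n C suc i) * (i !) * mixedStirling (n ∸ suc i) (suc k) t))
  ≡⟨ trans (sumBelow-*ˡ (t !) term n) (*-comm (t !) (sumBelow n term)) ⟩
    sumBelow n (λ i → (n C suc i) * (i !) * mixedStirling (n ∸ suc i) (suc k) t) * t !
  ≡⟨ cong (_* t !) (sym (sum-upTo _ n)) ⟩
    sum (map (λ i → (n C suc i) * (i !) * mixedStirling (n ∸ suc i) (suc k) t) (upTo n)) * t !
  ∎)
  where
  open ≡-Reasoning
  term : ℕ → ℕ
  term i = (n C suc i) * (i !) * mixedStirling (n ∸ suc i) (suc k) t
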